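{- The number of signed permutations in $B_n$ with exactly $m$ positive descents (equivalently, with exactly $m$ negative descents) is given by $$\sum_{i\geq0}\sum_{j=0}^i\sum_{k=0}^j(-1)^{i+j+k+n+m}k^{n+j-i}(i-j)!\binom{n}{i-j}\binom{i}{j}\binom{j}{k}\binom{n-i}{m}.$$
   Context: $B_n$ is the hyperoctahedral group (group of signed permutations), viewed as permutations $\pi=\pi_1\pi_2\cdots\pi_n$ of the alphabet $\{1,\dots,n,\bar{1},\dots,\bar{n}\}$ satisfying $\pi(\bar{i})=\overline{\pi(i)}$, where the alphabet is ordered as $\bar{1}<\cdots<\bar{n}(<0)<1<\cdots<n$. A signed permutation $\pi\in B_n$ has a positive descent at index $i$ if $\pi_i>\pi_{i+1}>0$, and a negative descent at index $i$ if $0>\pi_i>\pi_{i+1}$. The map $\pi_1\cdots\pi_n\mapsto(-\pi_1)\cdots(-\pi_n)$ shows that the number of signed permutations with exactly $m$ positive descents equals the number with exactly $m$ negative descents. -}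

module Defs where

open import Data.Nat using (ℕ; zero; suc; _+_; _*_; _∸_; _^_; _<ᵇ_; _!)
open import Data.Nat.Combinatorics using (_C_)
open import Data.Integer using (ℤ; +_; -_) renaming (_+_ to _+ℤ_; _*_ to _*ℤ_)
open import Data.Bool using (Bool; true; false; _∧_; if_then_else_)
open import Data.Fin using (Fin; toℕ)
open import Data.Vec using (Vec; []; _∷_; map)
open import Data.Vec.Relation.Unary.Unique.Propositional using (Unique)
open import Data.Product using (Σ; _×_; _,_; proj₂)
open import Data.List using (List; upTo; foldr)
open import Relation.Binary.PropositionalEquality using (_≡_)

-- A signed letter: a sign (true = positive, false = negative/barred) and an
-- absolute value, where  Fin n  index  a  stands for the value  a + 1 ∈ {1..n}.
Letter : ℕ → Set
Letter n = Bool × Fin n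

-- The distinctness proof is irrelevant, so two signed permutations
-- are equal iff their one-line words are equal.
record SignedPerm (n : ℕ) : Set where
  constructor sperm
  field
    word      : Vec (Letter n) n
    .distinct : Unique (map proj₂ word)
open SignedPerm public

-- Order on the alphabet  1̄ < ⋯ < n̄ (< 0) < 1 < ⋯ < n.
-- Positive descent at a pair (x , y):  x > y > 0, i.e. both positive, |x| > |y|.
isPosDesc : ∀ {n} → Letter n → Letter n → Bool
isPosDesc (true , a) (true , b) = toℕ b <ᵇ toℕ a
isPosDesc _ _ = false

-- Negative descent at (x , y):  0 > x > y, i.e. both barred and  x = ā, y = b̄
-- with  ā > b̄, which in this order means  a > b.
isNegDesc : ∀ {n} → Letter n → Letter n → Bool
isNegDesc (false , a) (false , b) = toℕ b <ᵇ toℕ a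
isNegDesc _ _ = false

countAdj : ∀ {A : Set} {k} → (A → A → Bool) → Vec A k → ℕ
countAdj d [] = 0
countAdj d (x ∷ []) = 0
countAdj d (x ∷ y ∷ w) = (if d x y then 1 else 0) + countAdj d (y ∷ w)

posDes : ∀ {n} → SignedPerm n → ℕ
posDes π = countAdj isPosDesc (word π)

negDes : ∀ {n} → SignedPerm n → ℕ
negDes π = countAdj isNegDesc (word π)

WithPosDes : ℕ → ℕ → Set
WithPosDes n m = Σ (SignedPerm n) λ π → posDes π ≡ m

WithNegDes : ℕ → ℕ → Set
WithNegDes n m = Σ (SignedPerm n) λ π → negDes π ≡ m

sumTo : ℕ → (ℕ → ℤ) → ℤ
sumTo N f = foldr (λ x acc → f x +ℤ acc) (+ 0) (upTo (suc N))

sgn : ℕ → ℤ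
sgn zero = + 1
sgn (suc e) = - sgn e

-- C(n,i-j) C(i,j) C(j,k) C(n-i,m)
-- (for i > n the binomial C(n-i,m) has negative upper index and vanishes, so the
-- sum over i ≥ 0 is the sum over 0 ≤ i ≤ n; here 0^0 = 1 and n + j - i ≥ 0
-- whenever C(n,i-j) ≠ 0.)
formula : ℕ → ℕ → ℤ
formula n m =
  sumTo n λ i → sumTo i λ j → sumTo j λ k →
    sgn (i + j + k + n + m) *ℤ
    + ((k ^ ((n + j) ∸ i)) * ((i ∸ j) !) * (n C (i ∸ j)) * (i C j) * (j C k) * ((n ∸ i) C m))

-- Write des π for the number of positive descents and pos π for the number of positive
-- letters of π ∈ Bₙ. Every element of Bₙ₊₁ arises exactly once by inserting n + 1 or its
-- negative into one of the n + 1 gaps of some π ∈ Bₙ. A positive insertion raises des by 0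
-- or 1, and by 1 in exactly pos π − des π gaps; a negative insertion lowers des by 0 or 1,
-- and by 1 in exactly des π gaps. This gives a recurrence for
-- W(n, s, p) = Σ_{pos π = p} C(des π, s), which is solved by
--   W(n, s, s + j) = l! C(n, l) C(l + j, j) Surj(s + j, j)   where l = n − s − j,
-- and Surj(e, j) = Σ_k (−1)^(j+k) kᵉ C(j, k) counts the surjections from an e-set onto a
-- j-set. Summing over j gives Σ_π C(des π, s), and binomial inversion
-- Σ_s (−1)^(s+m) C(s, m) C(d, s) = [d = m] turns these moments into the number of π with
-- des π = m; with i = n − s this is the triple sum. Negating all letters exchanges positive
-- and negative descents.

module Submission where

open import Algebra.Bundles using (CommutativeSemiring)
open import Data.Fin.Base as Fin using (Fin; toℕ)
open import Data.List.Base as List using (List; []; _∷_; _++_)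
open import Data.Nat.Base as ℕ using (ℕ; zero; suc; _∸_; _<_; z≤n; s≤s)
import Data.Nat.Properties as ℕ
open import Function using (_∘_)
import Relation.Binary.PropositionalEquality as ≡

-- Finite sums over a commutative semiring

module FiniteSums {c ℓ} (R : CommutativeSemiring c ℓ) where

  open CommutativeSemiring R
  open import Relation.Binary.Reasoning.Setoid setoid
  open import Algebra.Properties.CommutativeSemigroup +-commutativeSemigroup using (interchange)

  ∑ : ℕ → (ℕ → Carrier) → Carrier
  ∑ zero    f = 0#
  ∑ (suc n) f = f 0 + ∑ n (f ∘ suc)

  ∑-cong : ∀ n {f g : ℕ → Carrier} → (∀ i → i < n → f i ≈ g i) → ∑ n f ≈ ∑ n g
  ∑-cong zero    f≈g = refl
  ∑-cong (suc n) f≈g = +-cong (f≈g 0 (s≤s z≤n)) (∑-cong n (λ i i<n → f≈g (suc i) (s≤s i<n)))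

  ∑-zero : ∀ n {f : ℕ → Carrier} → (∀ i → i < n → f i ≈ 0#) → ∑ n f ≈ 0#
  ∑-zero zero    f≈0 = refl
  ∑-zero (suc n) f≈0 = trans (+-cong (f≈0 0 (s≤s z≤n)) (∑-zero n (λ i i<n → f≈0 (suc i) (s≤s i<n)))) (+-identityˡ 0#)

  ∑-+ : ∀ n (f g : ℕ → Carrier) → ∑ n (λ i → f i + g i) ≈ ∑ n f + ∑ n g
  ∑-+ zero    f g = sym (+-identityˡ 0#)
  ∑-+ (suc n) f g = trans (+-congˡ (∑-+ n (f ∘ suc) (g ∘ suc))) (interchange (f 0) (g 0) _ _)

  ∑-*ˡ : ∀ n x (f : ℕ → Carrier) → ∑ n (λ i → x * f i) ≈ x * ∑ n f
  ∑-*ˡ zero    x f = sym (zeroʳ x)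
  ∑-*ˡ (suc n) x f = trans (+-congˡ (∑-*ˡ n x (f ∘ suc))) (sym (distribˡ x (f 0) _))

  ∑-*ʳ : ∀ n x (f : ℕ → Carrier) → ∑ n (λ i → f i * x) ≈ ∑ n f * x
  ∑-*ʳ n x f = trans (∑-cong n (λ i _ → *-comm (f i) x)) (trans (∑-*ˡ n x f) (*-comm x (∑ n f)))

  ∑-snoc : ∀ n (f : ℕ → Carrier) → ∑ (suc n) f ≈ ∑ n f + f n
  ∑-snoc zero    f = trans (+-identityʳ (f 0)) (sym (+-identityˡ (f 0)))
  ∑-snoc (suc n) f = trans (+-congˡ (∑-snoc n (f ∘ suc))) (sym (+-assoc (f 0) _ _))

  ∑-shift : ∀ s r (f : ℕ → Carrier) → (∀ i → i < s → f i ≈ 0#) → ∑ (s ℕ.+ r) f ≈ ∑ r (λ j → f (s ℕ.+ j))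
  ∑-shift zero    r f f≈0 = refl
  ∑-shift (suc s) r f f≈0 =
    trans (+-cong (f≈0 0 (s≤s z≤n)) (∑-shift s r (f ∘ suc) (λ i i<s → f≈0 (suc i) (s≤s i<s)))) (+-identityˡ _)

  ∑-reverse : ∀ n (f : ℕ → Carrier) → ∑ n f ≈ ∑ n (λ i → f (n ∸ suc i))
  ∑-reverse zero    f = refl
  ∑-reverse (suc n) f = begin
    f 0 + ∑ n (f ∘ suc)                       ≈⟨ +-congˡ (∑-reverse n (f ∘ suc)) ⟩
    f 0 + ∑ n (λ i → f (suc (n ∸ suc i)))     ≈⟨ +-congˡ (∑-cong n (λ i i<n → reflexive (≡.cong f (ℕ.+-∸-assoc 1 i<n)))) ⟨
    f 0 + ∑ n (λ i → f (n ∸ i))               ≈⟨ +-comm (f 0) _ ⟩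
    ∑ n (λ i → f (n ∸ i)) + f 0               ≈⟨ reflexive (≡.cong (λ k → ∑ n (λ i → f (n ∸ i)) + f k) (ℕ.n∸n≡0 n)) ⟨
    ∑ n (λ i → f (n ∸ i)) + f (n ∸ n)         ≈⟨ ∑-snoc n (λ i → f (n ∸ i)) ⟨
    ∑ (suc n) (λ i → f (n ∸ i))               ∎

  module _ {a} {A : Set a} where

    ∑ᴸ : List A → (A → Carrier) → Carrier
    ∑ᴸ []       f = 0#
    ∑ᴸ (x ∷ xs) f = f x + ∑ᴸ xs f

    ∑ᴸ-cong : ∀ xs {f g : A → Carrier} → (∀ x → f x ≈ g x) → ∑ᴸ xs f ≈ ∑ᴸ xs g
    ∑ᴸ-cong []       f≈g = refl
    ∑ᴸ-cong (x ∷ xs) f≈g = +-cong (f≈g x) (∑ᴸ-cong xs f≈g)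

    ∑ᴸ-zero : ∀ xs {f : A → Carrier} → (∀ x → f x ≈ 0#) → ∑ᴸ xs f ≈ 0#
    ∑ᴸ-zero []       f≈0 = refl
    ∑ᴸ-zero (x ∷ xs) f≈0 = trans (+-cong (f≈0 x) (∑ᴸ-zero xs f≈0)) (+-identityˡ 0#)

    ∑ᴸ-*ˡ : ∀ xs y (f : A → Carrier) → ∑ᴸ xs (λ x → y * f x) ≈ y * ∑ᴸ xs f
    ∑ᴸ-*ˡ []       y f = sym (zeroʳ y)
    ∑ᴸ-*ˡ (x ∷ xs) y f = trans (+-congˡ (∑ᴸ-*ˡ xs y f)) (sym (distribˡ y (f x) _))

    ∑ᴸ-++ : ∀ xs ys (f : A → Carrier) → ∑ᴸ (xs ++ ys) f ≈ ∑ᴸ xs f + ∑ᴸ ys f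
    ∑ᴸ-++ []       ys f = sym (+-identityˡ _)
    ∑ᴸ-++ (x ∷ xs) ys f = trans (+-congˡ (∑ᴸ-++ xs ys f)) (sym (+-assoc (f x) _ _))

    ∑ᴸ-∑-comm : ∀ xs n (f : A → ℕ → Carrier) → ∑ᴸ xs (λ x → ∑ n (f x)) ≈ ∑ n (λ i → ∑ᴸ xs (λ x → f x i))
    ∑ᴸ-∑-comm []       n f = sym (∑-zero n (λ _ _ → refl))
    ∑ᴸ-∑-comm (x ∷ xs) n f =
      trans (+-congˡ (∑ᴸ-∑-comm xs n f)) (sym (∑-+ n (f x) (λ i → ∑ᴸ xs (λ y → f y i))))

    ∑ᴸ-+ : ∀ xs (f g : A → Carrier) → ∑ᴸ xs (λ x → f x + g x) ≈ ∑ᴸ xs f + ∑ᴸ xs g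
    ∑ᴸ-+ []       f g = sym (+-identityˡ 0#)
    ∑ᴸ-+ (x ∷ xs) f g = trans (+-congˡ (∑ᴸ-+ xs f g)) (interchange (f x) (g x) _ _)

    ∑ᴸ-tabulate : ∀ k (t : Fin k → A) (f : A → Carrier) (h : ℕ → Carrier) →
      (∀ i → f (t i) ≈ h (toℕ i)) → ∑ᴸ (List.tabulate t) f ≈ ∑ k h
    ∑ᴸ-tabulate zero    t f h f∘t≈h = refl
    ∑ᴸ-tabulate (suc k) t f h f∘t≈h = +-cong (f∘t≈h Fin.zero) (∑ᴸ-tabulate k (t ∘ Fin.suc) f (h ∘ suc) (f∘t≈h ∘ Fin.suc))

  ∑ᴸ-map : ∀ {a b} {A : Set a} {B : Set b} (h : A → B) xs (f : B → Carrier) → ∑ᴸ (List.map h xs) f ≈ ∑ᴸ xs (f ∘ h)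
  ∑ᴸ-map h []       f = refl
  ∑ᴸ-map h (x ∷ xs) f = +-congˡ (∑ᴸ-map h xs f)

  ∑ᴸ-cartesianProductWith : ∀ {a b d} {A : Set a} {B : Set b} {D : Set d} (h : A → B → D) xs ys (f : D → Carrier) →
    ∑ᴸ (List.cartesianProductWith h xs ys) f ≈ ∑ᴸ xs (λ x → ∑ᴸ ys (λ y → f (h x y)))
  ∑ᴸ-cartesianProductWith h []       ys f = refl
  ∑ᴸ-cartesianProductWith h (x ∷ xs) ys f =
    trans (∑ᴸ-++ (List.map (h x) ys) _ f) (+-cong (∑ᴸ-map (h x) ys f) (∑ᴸ-cartesianProductWith h xs ys f))

open import Algebra.Properties.CommutativeSemigroup ℕ.+-commutativeSemigroup using (x∙yz≈y∙xz; xy∙z≈xz∙y; interchange)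
open import Algebra.Properties.CommutativeSemigroup ℕ.*-commutativeSemigroup using () renaming (x∙yz≈y∙xz to x*[y*z]≡y*[x*z])
open import Data.Bool.Base using (Bool; true; false; _∧_; not; if_then_else_)
import Data.Bool.Properties as Bool
open import Data.Empty using (⊥-elim)
open import Data.Fin.Base using (zero; suc; fromℕ; inject₁; lower₁)
import Data.Fin.Properties as Fin
open import Data.Integer.Base using (ℤ; +_; -_; -1ℤ) renaming (_+_ to _+ℤ_; _*_ to _*ℤ_; _-_ to _-ℤ_)
import Data.Integer.Properties as ℤ
import Data.Integer.Tactic.RingSolver as ℤ-Ring
open import Data.List.Base using (length; filter; foldr; applyUpTo; allFin; cartesianProduct; cartesianProductWith)
open import Data.List.Properties using (filter-accept; filter-reject)
open import Data.List.Membership.Propositional using (_∈_)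
import Data.List.Membership.Propositional.Properties as ∈
open import Data.List.Membership.Propositional.Properties.WithK using (unique⇒irrelevant)
open import Data.List.Relation.Unary.All as ListAll using ([]; _∷_)
open import Data.List.Relation.Unary.AllPairs using ([]; _∷_)
open import Data.List.Relation.Unary.Any using (here; there; index)
import Data.List.Relation.Unary.Any.Properties as Any
open import Data.List.Relation.Unary.Unique.Propositional using () renaming (Unique to UniqueList)
import Data.List.Relation.Unary.Unique.Propositional.Properties as UniqueList
open import Data.Nat.Base using (_+_; _*_; _^_; _≤_; s≤s⁻¹; _<ᵇ_; _!)
open import Data.Nat.Properties using (_≤?_; _<?_)
open import Data.Nat.Combinatorics using (_C_; nCk+nC[k+1]≡[n+1]C[k+1]; k>n⇒nCk≡0; nCn≡1; nC1≡n; nCk≡nC[n∸k])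
open import Data.Nat.Tactic.RingSolver using (solve-∀)
open import Data.Product.Base using (Σ; ∃; ∃₂; _×_; _,_; proj₁; proj₂; map₁; map₂)
open import Data.Sum.Base using (_⊎_; inj₁; inj₂)
open import Data.Vec.Base using (Vec; []; _∷_; map; lookup; insertAt; removeAt)
import Data.Vec.Properties as Vec
open import Data.Vec.Relation.Unary.All using (All; []; _∷_)
import Data.Vec.Relation.Unary.All as All
import Data.Vec.Relation.Unary.All.Properties as All
open import Data.Vec.Relation.Unary.AllPairs using (allPairs?; []; _∷_)
open import Data.Vec.Relation.Unary.Unique.Propositional using (Unique)
import Data.Vec.Relation.Unary.Unique.Propositional.Properties as Unique
open import Function using (id)
open import Function.Bundles using (_↔_; mk↔ₛ′)
open import Function.Properties.Inverse using (↔-trans)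
open import Relation.Nullary using (yes; no; ¬?)
open import Relation.Nullary.Decidable using (recompute)
open import Relation.Unary using (Decidable)
open import Relation.Binary.PropositionalEquality using (_≡_; _≢_; refl; sym; trans; cong; cong₂; subst; module ≡-Reasoning)
open ≡-Reasoning
open import Defs

open FiniteSums ℕ.+-*-commutativeSemiring
module ℤ∑ = FiniteSums ℤ.+-*-commutativeSemiring

+-∑ : ∀ n (f : ℕ → ℕ) → + ∑ n f ≡ ℤ∑.∑ n (λ i → + f i)
+-∑ zero    f = refl
+-∑ (suc n) f = trans (ℤ.pos-+ (f 0) _) (cong (+ f 0 +ℤ_) (+-∑ n (λ i → f (suc i))))

+-∑ᴸ : ∀ {a} {A : Set a} (xs : List A) (f : A → ℕ) → + ∑ᴸ xs f ≡ ℤ∑.∑ᴸ xs (λ x → + f x)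
+-∑ᴸ []       f = refl
+-∑ᴸ (x ∷ xs) f = trans (ℤ.pos-+ (f x) _) (cong (+ f x +ℤ_) (+-∑ᴸ xs f))

∑-const : ∀ n c → ∑ n (λ _ → c) ≡ n * c
∑-const zero    c = refl
∑-const (suc n) c = cong (_+_ c) (∑-const n c)

-- Binomial coefficients

-- Pascal's recursion makes binomials unfold on symbolic arguments, which
-- the library's division-based _C_ does not.
infix 8 _choose_ _choose⁻_

_choose_ : ℕ → ℕ → ℕ
_     choose zero  = 1
zero  choose suc k = 0
suc n choose suc k = n choose k + n choose suc k

choose≡C : ∀ n k → n choose k ≡ n C k
choose≡C n       zero    = refl
choose≡C zero    (suc k) = refl
choose≡C (suc n) (suc k) =
  trans (cong₂ _+_ (choose≡C n k) (choose≡C n (suc k))) (nCk+nC[k+1]≡[n+1]C[k+1] n k)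

choose-vanish : ∀ {n k} → n < k → n choose k ≡ 0
choose-vanish {n} {k} n<k = trans (choose≡C n k) (k>n⇒nCk≡0 n<k)

choose-diag : ∀ n → n choose n ≡ 1
choose-diag n = trans (choose≡C n n) (nCn≡1 n)

choose-1 : ∀ n → n choose 1 ≡ n
choose-1 n = trans (choose≡C n 1) (nC1≡n n)

choose-sym : ∀ a b → (a + b) choose a ≡ (a + b) choose b
choose-sym a b = begin
  (a + b) choose a          ≡⟨ choose≡C (a + b) a ⟩
  (a + b) C a               ≡⟨ nCk≡nC[n∸k] (ℕ.m≤m+n a b) ⟩
  (a + b) C (a + b ∸ a)     ≡⟨ cong ((a + b) C_) (ℕ.m+n∸m≡n a b) ⟩
  (a + b) C b               ≡⟨ choose≡C (a + b) b ⟨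
  (a + b) choose b          ∎

choose-absorb : ∀ n k → suc k * (suc n choose suc k) ≡ suc n * (n choose k)
choose-absorb n       zero    = trans (ℕ.+-identityʳ _) (trans (choose-1 (suc n)) (sym (ℕ.*-identityʳ (suc n))))
choose-absorb zero    (suc k) = ℕ.*-zeroʳ (suc k)
choose-absorb (suc n) (suc k) = begin
  suc (suc k) * (a + b)                          ≡⟨ lhs k a b ⟩
  suc k * a + a + suc (suc k) * b                ≡⟨ cong₂ (λ x y → x + a + y) (choose-absorb n k) (choose-absorb n (suc k)) ⟩
  suc n * (n choose k) + a + suc n * (n choose suc k) ≡⟨ rhs n (n choose k) (n choose suc k) ⟩
  suc (suc n) * (n choose k + n choose suc k)   ∎
  where
  a = suc n choose suc k
  b = suc n choose suc (suc k)
  lhs : ∀ k a b → suc (suc k) * (a + b) ≡ suc k * a + a + suc (suc k) * b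
  lhs = solve-∀
  rhs : ∀ n x y → suc n * x + (x + y) + suc n * y ≡ suc (suc n) * (x + y)
  rhs = solve-∀

-- n choose⁻ k is C(n, k − 1), where C(n, −1) = 0 (unlike n choose (k ∸ 1)).
_choose⁻_ : ℕ → ℕ → ℕ
n choose⁻ zero  = 0
n choose⁻ suc k = n choose k

choose⁻-vanish : ∀ {n k} → suc n < k → n choose⁻ k ≡ 0
choose⁻-vanish {k = suc k} (s≤s n<k) = choose-vanish n<k

choose-suc : ∀ n k → suc n choose k ≡ n choose k + n choose⁻ k
choose-suc n zero    = refl
choose-suc n (suc k) = ℕ.+-comm (n choose k) _

choose-+≤1 : ∀ n e k → e ≤ 1 → (n + e) choose k ≡ n choose k + e * n choose⁻ k
choose-+≤1 n .0 k z≤n = trans (cong (_choose k) (ℕ.+-identityʳ n)) (sym (ℕ.+-identityʳ (n choose k)))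
choose-+≤1 n .1 k (s≤s z≤n) =
  trans (cong (_choose k) (ℕ.+-comm n 1)) (trans (choose-suc n k) (cong (_+_ (n choose k)) (sym (ℕ.+-identityʳ _))))

*-choose-suc : ∀ n k → suc k * n choose suc k ≡ (n ∸ k) * n choose k
*-choose-suc zero    k       = trans (ℕ.*-zeroʳ (suc k)) (cong (_* 0 choose k) (sym (ℕ.0∸n≡0 k)))
*-choose-suc (suc n) zero    = trans (ℕ.+-identityʳ _) (trans (choose-1 (suc n)) (sym (ℕ.*-identityʳ (suc n))))
*-choose-suc (suc n) (suc k) with k <? n
... | yes k<n = begin
  suc (suc k) * (b₁ + b₂)                    ≡⟨ ℕ.*-distribˡ-+ (suc (suc k)) b₁ b₂ ⟩
  suc (suc k) * b₁ + suc (suc k) * b₂        ≡⟨ cong (_+_ (suc (suc k) * b₁)) (*-choose-suc n (suc k)) ⟩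
  suc (suc k) * b₁ + (n ∸ suc k) * b₁        ≡⟨ regroup k (n ∸ suc k) b₁ ⟩
  suc k * b₁ + suc (n ∸ suc k) * b₁          ≡⟨ cong₂ (λ x y → x + y * b₁) (*-choose-suc n k) (sym (ℕ.+-∸-assoc 1 k<n)) ⟩
  (n ∸ k) * b₀ + (n ∸ k) * b₁                ≡⟨ ℕ.*-distribˡ-+ (n ∸ k) b₀ b₁ ⟨
  (n ∸ k) * (b₀ + b₁)                        ∎
  where
  b₀ = n choose k
  b₁ = n choose suc k
  b₂ = n choose suc (suc k)
  regroup : ∀ k x b → suc (suc k) * b + x * b ≡ suc k * b + suc x * b
  regroup = solve-∀
... | no k≮n = begin
  suc (suc k) * (n choose suc k + n choose suc (suc k))
    ≡⟨ cong₂ (λ x y → suc (suc k) * (x + y)) (choose-vanish (s≤s n≤k)) (choose-vanish (s≤s (ℕ.m≤n⇒m≤1+n n≤k))) ⟩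
  suc (suc k) * 0                                        ≡⟨ ℕ.*-zeroʳ (suc (suc k)) ⟩
  0                                                      ≡⟨ cong (_* (n choose k + n choose suc k)) (ℕ.m≤n⇒m∸n≡0 n≤k) ⟨
  (n ∸ k) * (n choose k + n choose suc k)                ∎
  where
  n≤k = ℕ.≮⇒≥ k≮n

*-choose≡∸-*-choose⁻ : ∀ n k → k * n choose k ≡ (suc n ∸ k) * n choose⁻ k
*-choose≡∸-*-choose⁻ n zero    = sym (ℕ.*-zeroʳ (suc n))
*-choose≡∸-*-choose⁻ n (suc k) = *-choose-suc n k

*-choose⁻≡*-choose : ∀ n k → n * (n ∸ 1) choose⁻ k ≡ k * n choose k
*-choose⁻≡*-choose n       zero    = ℕ.*-zeroʳ n
*-choose⁻≡*-choose zero    (suc k) = sym (ℕ.*-zeroʳ (suc k))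
*-choose⁻≡*-choose (suc n) (suc k) = sym (choose-absorb n k)

choose-absorb-+ʳ : ∀ a b → (a + suc b) * (a + b) choose b ≡ suc b * (a + suc b) choose suc b
choose-absorb-+ʳ a b = begin
  (a + suc b) * (a + b) choose b          ≡⟨ cong (_* (a + b) choose b) (ℕ.+-suc a b) ⟩
  suc (a + b) * (a + b) choose b          ≡⟨ choose-absorb (a + b) b ⟨
  suc b * suc (a + b) choose suc b        ≡⟨ cong (λ m → suc b * m choose suc b) (ℕ.+-suc a b) ⟨
  suc b * (a + suc b) choose suc b        ∎

choose-absorb-+ˡ : ∀ a b → (suc a + b) * (a + b) choose b ≡ suc a * (suc a + b) choose b
choose-absorb-+ˡ a b = begin
  suc (a + b) * (a + b) choose b          ≡⟨ cong (suc (a + b) *_) (choose-sym a b) ⟨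
  suc (a + b) * (a + b) choose a          ≡⟨ choose-absorb (a + b) a ⟨
  suc a * (suc a + b) choose suc a        ≡⟨ cong (suc a *_) (choose-sym (suc a) b) ⟩
  suc a * (suc a + b) choose b            ∎

sgn-+ : ∀ a b → sgn (a + b) ≡ sgn a *ℤ sgn b
sgn-+ zero    b = sym (ℤ.*-identityˡ (sgn b))
sgn-+ (suc a) b = trans (cong -_ (sgn-+ a b)) (ℤ.neg-distribˡ-* (sgn a) (sgn b))

sgn-double : ∀ a → sgn (a + a) ≡ + 1
sgn-double zero    = refl
sgn-double (suc a) = trans (cong (λ k → - sgn k) (ℕ.+-suc a a)) (trans (ℤ.neg-involutive _) (sgn-double a))

δ : ℕ → ℕ → ℕ
δ zero    zero    = 1
δ zero    (suc n) = 0
δ (suc m) zero    = 0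
δ (suc m) (suc n) = δ m n

δ-refl : ∀ m → δ m m ≡ 1
δ-refl zero    = refl
δ-refl (suc m) = δ-refl m

δ-≢ : ∀ {m n} → m ≢ n → δ m n ≡ 0
δ-≢ {zero}  {zero}  m≢n = ⊥-elim (m≢n refl)
δ-≢ {zero}  {suc n} _   = refl
δ-≢ {suc m} {zero}  _   = refl
δ-≢ {suc m} {suc n} m≢n = δ-≢ (m≢n ∘ cong suc)

δ-subst : ∀ m n (f : ℕ → ℕ) → δ m n * f m ≡ δ m n * f n
δ-subst zero    zero    f = refl
δ-subst zero    (suc n) f = refl
δ-subst (suc m) zero    f = refl
δ-subst (suc m) (suc n) f = δ-subst m n (f ∘ suc)

∑-δ : ∀ N q c → q < N → ∑ N (λ p → δ q p * c) ≡ c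
∑-δ (suc N) zero    c _         = trans (cong (_+_ (1 * c)) (∑-zero N (λ _ _ → refl))) (trans (ℕ.+-identityʳ (1 * c)) (ℕ.*-identityˡ c))
∑-δ (suc N) (suc q) c (s≤s q<N) = ∑-δ N q c q<N

-- Binomial inversion

inversionTerm : ℕ → ℕ → ℕ → ℤ
inversionTerm d m s = sgn (s + m) *ℤ + (s choose m * d choose s)

inversionTerm⁻ : ℕ → ℕ → ℕ → ℤ
inversionTerm⁻ d zero    s = + 0
inversionTerm⁻ d (suc m) s = inversionTerm d m s

private
  sgn-suc-choose⁻ : ∀ d m t → sgn (suc t + m) *ℤ + (t choose⁻ m * d choose t) ≡ inversionTerm⁻ d m t
  sgn-suc-choose⁻ d zero    t = ℤ.*-zeroʳ (sgn (suc t + 0))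
  sgn-suc-choose⁻ d (suc m) t =
    cong (λ σ → σ *ℤ + (t choose m * d choose t)) (trans (cong (λ k → - sgn k) (ℕ.+-suc t m)) (ℤ.neg-involutive _))

inversionTerm-pascal : ∀ d m t →
  inversionTerm (suc d) m (suc t) ≡ inversionTerm d m (suc t) +ℤ (inversionTerm⁻ d m t +ℤ - inversionTerm d m t)
inversionTerm-pascal d m t = begin
  σ *ℤ + (suc t choose m * (c + c′))
    ≡⟨ cong (λ x → σ *ℤ + (x * (c + c′))) (choose-suc t m) ⟩
  σ *ℤ + ((a + a⁻) * (c + c′))
    ≡⟨ cong (σ *ℤ_) (trans (cong +_ (expand a a⁻ c c′))
                           (trans (ℤ.pos-+ ((a + a⁻) * c′) _) (cong (+ ((a + a⁻) * c′) +ℤ_) (ℤ.pos-+ (a⁻ * c) (a * c))))) ⟩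
  σ *ℤ (+ ((a + a⁻) * c′) +ℤ (+ (a⁻ * c) +ℤ + (a * c)))
    ≡⟨ distribute (sgn (t + m)) (+ ((a + a⁻) * c′)) (+ (a⁻ * c)) (+ (a * c)) ⟩
  σ *ℤ + ((a + a⁻) * c′) +ℤ (σ *ℤ + (a⁻ * c) +ℤ - (sgn (t + m) *ℤ + (a * c)))
    ≡⟨ cong₂ (λ x y → σ *ℤ + (x * c′) +ℤ (y +ℤ - inversionTerm d m t)) (sym (choose-suc t m)) (sgn-suc-choose⁻ d m t) ⟩
  inversionTerm d m (suc t) +ℤ (inversionTerm⁻ d m t +ℤ - inversionTerm d m t) ∎
  where
  σ  = sgn (suc t + m)
  a  = t choose m
  a⁻ = t choose⁻ m
  c  = d choose t
  c′ = d choose suc t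
  expand : ∀ a a⁻ c c′ → (a + a⁻) * (c + c′) ≡ (a + a⁻) * c′ + (a⁻ * c + a * c)
  expand = solve-∀
  distribute : ∀ s x y z → - s *ℤ (x +ℤ (y +ℤ z)) ≡ - s *ℤ x +ℤ (- s *ℤ y +ℤ - (s *ℤ z))
  distribute = ℤ-Ring.solve-∀

ℤ∑-neg : ∀ n (f : ℕ → ℤ) → ℤ∑.∑ n (λ i → - f i) ≡ - ℤ∑.∑ n f
ℤ∑-neg n f = begin
  ℤ∑.∑ n (λ i → - f i)          ≡⟨ ℤ∑.∑-cong n (λ i _ → sym (ℤ.-1*i≡-i (f i))) ⟩
  ℤ∑.∑ n (λ i → -1ℤ *ℤ f i)   ≡⟨ ℤ∑.∑-*ˡ n -1ℤ f ⟩
  -1ℤ *ℤ ℤ∑.∑ n f             ≡⟨ ℤ.-1*i≡-i _ ⟩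
  - ℤ∑.∑ n f                    ∎

inversionTerm-vanish : ∀ {d s} m → d < s → inversionTerm d m s ≡ + 0
inversionTerm-vanish {d} {s} m d<s =
  trans (cong (λ x → sgn (s + m) *ℤ + (s choose m * x)) (choose-vanish d<s))
        (trans (cong (λ x → sgn (s + m) *ℤ + x) (ℕ.*-zeroʳ (s choose m))) (ℤ.*-zeroʳ (sgn (s + m))))

-- By Pascal's rule in d, the sum for d + 1 is the sum for d with m lowered by one.
binomial-inversion : ∀ {d N} m → d < N → ℤ∑.∑ N (inversionTerm d m) ≡ + δ d m
binomial-inversion {zero} {suc N} m _ =
  trans (cong (_+ℤ_ (inversionTerm 0 m 0)) (ℤ∑.∑-zero N (λ i _ → inversionTerm-vanish {s = suc i} m (s≤s z≤n))))
        (trans (ℤ.+-identityʳ _) (base m))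
  where
  base : ∀ m → inversionTerm 0 m 0 ≡ + δ 0 m
  base zero    = refl
  base (suc m) = ℤ.*-zeroʳ (sgn (suc m))
binomial-inversion {suc d} {suc N} m (s≤s d<N) = begin
  ℤ∑.∑ (suc N) (inversionTerm (suc d) m)
    ≡⟨ cong (inversionTerm d m 0 +ℤ_) (trans (ℤ∑.∑-cong N (λ t _ → inversionTerm-pascal d m t)) (ℤ∑.∑-+ N shifted Δ)) ⟩
  inversionTerm d m 0 +ℤ (ℤ∑.∑ N shifted +ℤ ℤ∑.∑ N Δ)
    ≡⟨ ℤ.+-assoc (inversionTerm d m 0) (ℤ∑.∑ N shifted) (ℤ∑.∑ N Δ) ⟨
  ℤ∑.∑ (suc N) (inversionTerm d m) +ℤ ℤ∑.∑ N Δ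
    ≡⟨ cong₂ _+ℤ_ (ℤ∑.∑-snoc N (inversionTerm d m))
                  (trans (ℤ∑.∑-+ N (inversionTerm⁻ d m) (λ t → - inversionTerm d m t))
                         (cong (S⁻ +ℤ_) (ℤ∑-neg N (inversionTerm d m)))) ⟩
  S +ℤ inversionTerm d m N +ℤ (S⁻ +ℤ - S)
    ≡⟨ cong (λ x → S +ℤ x +ℤ (S⁻ +ℤ - S)) (inversionTerm-vanish m d<N) ⟩
  S +ℤ + 0 +ℤ (S⁻ +ℤ - S)
    ≡⟨ cancel S S⁻ ⟩
  S⁻
    ≡⟨ lower m ⟩
  + δ (suc d) m ∎
  where
  shifted = λ t → inversionTerm d m (suc t)
  Δ = λ t → inversionTerm⁻ d m t +ℤ - inversionTerm d m t
  S = ℤ∑.∑ N (inversionTerm d m)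
  S⁻ = ℤ∑.∑ N (inversionTerm⁻ d m)
  cancel : ∀ x y → x +ℤ + 0 +ℤ (y +ℤ - x) ≡ y
  cancel = ℤ-Ring.solve-∀
  lower : ∀ m → ℤ∑.∑ N (inversionTerm⁻ d m) ≡ + δ (suc d) m
  lower zero    = ℤ∑.∑-zero N (λ _ _ → refl)
  lower (suc m) = binomial-inversion m d<N

-- Surjection numbers

surjections : ℕ → ℕ → ℕ
surjections zero    zero    = 1
surjections zero    (suc j) = 0
surjections (suc e) zero    = 0
surjections (suc e) (suc j) = suc j * (surjections e (suc j) + surjections e j)

surjections-vanish : ∀ {e j} → e < j → surjections e j ≡ 0
surjections-vanish {zero}  {suc j} _         = refl
surjections-vanish {suc e} {suc j} (s≤s e<j) =
  trans (cong (suc j *_) (cong₂ _+_ (surjections-vanish (ℕ.m≤n⇒m≤1+n e<j)) (surjections-vanish e<j))) (ℕ.*-zeroʳ (suc j))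

surjectionTerm : ℕ → ℕ → ℕ → ℤ
surjectionTerm e j k = sgn (j + k) *ℤ + (k ^ e * j choose k)

private
  ^-absorb : ∀ e j k →
    suc k ^ suc e * suc j choose suc k + suc j * (suc k ^ e * j choose suc k) ≡ suc j * (suc k ^ e * suc j choose suc k)
  ^-absorb e j k = begin
    suc k * p * (b + b′) + suc j * (p * b′)   ≡⟨ cong (_+ suc j * (p * b′)) (reassoc (suc k) p (b + b′)) ⟩
    p * (suc k * (b + b′)) + suc j * (p * b′) ≡⟨ cong (λ x → p * x + suc j * (p * b′)) (choose-absorb j k) ⟩
    p * (suc j * b) + suc j * (p * b′)        ≡⟨ collect p (suc j) b b′ ⟩
    suc j * (p * (b + b′))                    ∎
    where
    p  = suc k ^ e
    b  = j choose k
    b′ = j choose suc k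
    reassoc : ∀ x p b → x * p * b ≡ p * (x * b)
    reassoc = solve-∀
    collect : ∀ p J b b′ → p * (J * b) + J * (p * b′) ≡ J * (p * (b + b′))
    collect = solve-∀

surjectionTerm-step : ∀ e j k →
  surjectionTerm (suc e) (suc j) k ≡ + suc j *ℤ surjectionTerm e (suc j) k +ℤ + suc j *ℤ surjectionTerm e j k
surjectionTerm-step e j zero    = cancel (sgn (j + 0)) (+ suc j) (+ (0 ^ e * 1))
  where
  cancel : ∀ s J x → - s *ℤ + 0 ≡ J *ℤ (- s *ℤ x) +ℤ J *ℤ (s *ℤ x)
  cancel = ℤ-Ring.solve-∀
surjectionTerm-step e j (suc k) = begin
  - s *ℤ + a                                      ≡⟨ cong (- s *ℤ_) (subtract-from (+ a) (+ suc j *ℤ + z)) ⟩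
  - s *ℤ (+ a +ℤ + suc j *ℤ + z -ℤ + suc j *ℤ + z) ≡⟨ cong (λ x → - s *ℤ (x -ℤ + suc j *ℤ + z)) lifted ⟩
  - s *ℤ (+ suc j *ℤ + y -ℤ + suc j *ℤ + z)        ≡⟨ distribute s (+ suc j) (+ y) (+ z) ⟩
  + suc j *ℤ (- s *ℤ + y) +ℤ + suc j *ℤ (s *ℤ + z) ∎
  where
  s = sgn (j + suc k)
  a = suc k ^ suc e * suc j choose suc k
  y = suc k ^ e * suc j choose suc k
  z = suc k ^ e * j choose suc k
  lifted : + a +ℤ + suc j *ℤ + z ≡ + suc j *ℤ + y
  lifted = trans (cong (+ a +ℤ_) (sym (ℤ.pos-* (suc j) z)))
           (trans (sym (ℤ.pos-+ a (suc j * z))) (trans (cong +_ (^-absorb e j k)) (ℤ.pos-* (suc j) y)))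
  subtract-from : ∀ a b → a ≡ a +ℤ b -ℤ b
  subtract-from = ℤ-Ring.solve-∀
  distribute : ∀ s J y z → - s *ℤ (J *ℤ y -ℤ J *ℤ z) ≡ J *ℤ (- s *ℤ y) +ℤ J *ℤ (s *ℤ z)
  distribute = ℤ-Ring.solve-∀

-- The case e = 0 is the binomial theorem at −1, a special case of binomial-inversion.
∑-surjectionTerm : ∀ e j → ℤ∑.∑ (suc j) (surjectionTerm e j) ≡ + surjections e j
∑-surjectionTerm zero    zero    = refl
∑-surjectionTerm zero    (suc j) = begin
  ℤ∑.∑ (suc (suc j)) (surjectionTerm 0 (suc j))                  ≡⟨ ℤ∑.∑-cong (suc (suc j)) (λ k _ → split-sign k) ⟩
  ℤ∑.∑ (suc (suc j)) (λ k → sgn (suc j) *ℤ inversionTerm (suc j) 0 k) ≡⟨ ℤ∑.∑-*ˡ (suc (suc j)) (sgn (suc j)) (inversionTerm (suc j) 0) ⟩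
  sgn (suc j) *ℤ ℤ∑.∑ (suc (suc j)) (inversionTerm (suc j) 0)    ≡⟨ cong (sgn (suc j) *ℤ_) (binomial-inversion {suc j} 0 ℕ.≤-refl) ⟩
  sgn (suc j) *ℤ + 0                                              ≡⟨ ℤ.*-zeroʳ (sgn (suc j)) ⟩
  + 0                                                             ∎
  where
  split-sign : ∀ k → surjectionTerm 0 (suc j) k ≡ sgn (suc j) *ℤ inversionTerm (suc j) 0 k
  split-sign k = begin
    sgn (suc j + k) *ℤ c                ≡⟨ cong (_*ℤ c) (sgn-+ (suc j) k) ⟩
    sgn (suc j) *ℤ sgn k *ℤ c           ≡⟨ ℤ.*-assoc (sgn (suc j)) (sgn k) c ⟩
    sgn (suc j) *ℤ (sgn k *ℤ c)         ≡⟨ cong (λ i → sgn (suc j) *ℤ (sgn i *ℤ c)) (ℕ.+-identityʳ k) ⟨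
    sgn (suc j) *ℤ (sgn (k + 0) *ℤ c)   ∎
    where c = + (1 * suc j choose k)
∑-surjectionTerm (suc e) zero    = refl
∑-surjectionTerm (suc e) (suc j) = begin
  ℤ∑.∑ (suc (suc j)) (surjectionTerm (suc e) (suc j))
    ≡⟨ ℤ∑.∑-cong (suc (suc j)) (λ k _ → surjectionTerm-step e j k) ⟩
  ℤ∑.∑ (suc (suc j)) (λ k → J *ℤ surjectionTerm e (suc j) k +ℤ J *ℤ surjectionTerm e j k)
    ≡⟨ ℤ∑.∑-+ (suc (suc j)) (λ k → J *ℤ surjectionTerm e (suc j) k) (λ k → J *ℤ surjectionTerm e j k) ⟩
  ℤ∑.∑ (suc (suc j)) (λ k → J *ℤ surjectionTerm e (suc j) k) +ℤ ℤ∑.∑ (suc (suc j)) (λ k → J *ℤ surjectionTerm e j k)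
    ≡⟨ cong₂ _+ℤ_ (ℤ∑.∑-*ˡ (suc (suc j)) J (surjectionTerm e (suc j))) (ℤ∑.∑-*ˡ (suc (suc j)) J (surjectionTerm e j)) ⟩
  J *ℤ ℤ∑.∑ (suc (suc j)) (surjectionTerm e (suc j)) +ℤ J *ℤ ℤ∑.∑ (suc (suc j)) (surjectionTerm e j)
    ≡⟨ cong₂ (λ x y → J *ℤ x +ℤ J *ℤ y) (∑-surjectionTerm e (suc j)) drop-last ⟩
  J *ℤ + surjections e (suc j) +ℤ J *ℤ + surjections e j
    ≡⟨ ℤ.*-distribˡ-+ J (+ surjections e (suc j)) (+ surjections e j) ⟨
  J *ℤ (+ surjections e (suc j) +ℤ + surjections e j)
    ≡⟨ cong (J *ℤ_) (ℤ.pos-+ (surjections e (suc j)) (surjections e j)) ⟨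
  J *ℤ + (surjections e (suc j) + surjections e j)
    ≡⟨ ℤ.pos-* (suc j) (surjections e (suc j) + surjections e j) ⟨
  + surjections (suc e) (suc j) ∎
  where
  J = + suc j
  drop-last : ℤ∑.∑ (suc (suc j)) (surjectionTerm e j) ≡ + surjections e j
  drop-last = begin
    ℤ∑.∑ (suc (suc j)) (surjectionTerm e j)                         ≡⟨ ℤ∑.∑-snoc (suc j) (surjectionTerm e j) ⟩
    ℤ∑.∑ (suc j) (surjectionTerm e j) +ℤ surjectionTerm e j (suc j) ≡⟨ cong₂ _+ℤ_ (∑-surjectionTerm e j) vanish ⟩
    + surjections e j +ℤ + 0                                        ≡⟨ ℤ.+-identityʳ (+ surjections e j) ⟩
    + surjections e j                                               ∎
    where
    vanish : surjectionTerm e j (suc j) ≡ + 0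
    vanish = trans (cong (λ x → sgn (j + suc j) *ℤ + (suc j ^ e * x)) (choose-vanish {j} ℕ.≤-refl))
                   (trans (cong (λ x → sgn (j + suc j) *ℤ + x) (ℕ.*-zeroʳ (suc j ^ e))) (ℤ.*-zeroʳ (sgn (j + suc j))))

-- Descents of signed words

<ᵇ-false : ∀ {m n} → n ≤ m → (m <ᵇ n) ≡ false
<ᵇ-false z≤n     = refl
<ᵇ-false (s≤s p) = <ᵇ-false p

<ᵇ-true : ∀ {m n} → m < n → (m <ᵇ n) ≡ true
<ᵇ-true (s≤s z≤n)       = refl
<ᵇ-true (s≤s (s≤s m<n)) = <ᵇ-true (s≤s m<n)

bit : Bool → ℕ
bit b = if b then 1 else 0

bit≤1 : ∀ b → bit b ≤ 1
bit≤1 true  = s≤s z≤n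
bit≤1 false = z≤n

-- Signed letters with values in ℕ rather than Fin n, so that a letter larger than all
-- others can be inserted without lifting the rest.
Symbol : Set
Symbol = Bool × ℕ

descent : Symbol → Symbol → Bool
descent (true , a) (true , b) = b <ᵇ a
descent _          _          = false

descentsAfter : Symbol → List Symbol → ℕ
descentsAfter x []      = 0
descentsAfter x (y ∷ w) = bit (descent x y) + descentsAfter y w

positives : List Symbol → ℕ
positives []            = 0
positives ((b , _) ∷ w) = bit b + positives w

insert : List Symbol → ℕ → Symbol → List Symbol
insert w       zero    t = t ∷ w
insert []      (suc g) t = t ∷ []
insert (x ∷ w) (suc g) t = x ∷ insert w g t

Below : ℕ → Symbol → Set
Below N x = proj₂ x < N

positives-insert : ∀ w g b N → positives (insert w g (b , N)) ≡ bit b + positives w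
positives-insert w             zero    b N = refl
positives-insert []            (suc g) b N = refl
positives-insert ((c , _) ∷ w) (suc g) b N =
  trans (cong (_+_ (bit c)) (positives-insert w g b N)) (x∙yz≈y∙xz (bit c) (bit b) (positives w))

positives≤length : ∀ w → positives w ≤ length w
positives≤length []            = z≤n
positives≤length ((b , _) ∷ w) = ℕ.+-mono-≤ (bit≤1 b) (positives≤length w)

descent⇒positive : ∀ x y → descent x y ≡ true → proj₁ y ≡ true
descent⇒positive (true , a)  (true , b)  _  = refl
descent⇒positive (true , a)  (false , b) ()
descent⇒positive (false , a) y           ()

descent-≤-positive : ∀ x y → bit (descent x y) ≤ bit (proj₁ y)
descent-≤-positive x y with descent x y in eq
... | false = z≤n
... | true  rewrite descent⇒positive x y eq = s≤s z≤n

descentsAfter≤positives : ∀ x w → descentsAfter x w ≤ positives w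
descentsAfter≤positives x []      = z≤n
descentsAfter≤positives x (y ∷ w) = ℕ.+-mono-≤ (descent-≤-positive x y) (descentsAfter≤positives y w)

descent-top : ∀ {N} y → Below N y → descent (true , N) y ≡ proj₁ y
descent-top (true , a)  a<N = <ᵇ-true a<N
descent-top (false , a) _   = refl

descent-to-top : ∀ {N} x b → Below N x → descent x (b , N) ≡ false
descent-to-top (true , a)  true  a<N = <ᵇ-false (ℕ.<⇒≤ a<N)
descent-to-top (true , a)  false _   = refl
descent-to-top (false , a) b     _   = refl

descent-to-negative : ∀ x N → descent x (false , N) ≡ false
descent-to-negative (true , a)  N = refl
descent-to-negative (false , a) N = refl

-- Inserting a positive top letter just before y creates a descent iff
-- y is positive and not already the bottom of a descent.
newDescent : Symbol → List Symbol → ℕ → ℕ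
newDescent x []      g       = 0
newDescent x (y ∷ w) zero    = bit (proj₁ y ∧ not (descent x y))
newDescent x (y ∷ w) (suc g) = newDescent y w g

newDescent≤1 : ∀ x w g → newDescent x w g ≤ 1
newDescent≤1 x []      g       = z≤n
newDescent≤1 x (y ∷ w) zero    = bit≤1 (proj₁ y ∧ not (descent x y))
newDescent≤1 x (y ∷ w) (suc g) = newDescent≤1 y w g

bit-positive-split : ∀ x y → bit (proj₁ y) ≡ bit (descent x y) + bit (proj₁ y ∧ not (descent x y))
bit-positive-split x y with descent x y in eq
... | true rewrite descent⇒positive x y eq = refl
... | false with proj₁ y
...   | true  = refl
...   | false = refl

descentsAfter-insert⁺ : ∀ {N} x w g → descent x (true , N) ≡ false → ListAll.All (Below N) w →
  descentsAfter x (insert w g (true , N)) ≡ descentsAfter x w + newDescent x w g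
descentsAfter-insert⁺ x [] zero    x↛N [] = cong (λ b → bit b + 0) x↛N
descentsAfter-insert⁺ x [] (suc g) x↛N [] = cong (λ b → bit b + 0) x↛N
descentsAfter-insert⁺ {N} x (y ∷ w) zero x↛N (y<N ∷ _) = begin
  bit (descent x (true , N)) + (bit (descent (true , N) y) + descentsAfter y w)
    ≡⟨ cong₂ (λ b c → bit b + (bit c + descentsAfter y w)) x↛N (descent-top y y<N) ⟩
  bit (proj₁ y) + descentsAfter y w
    ≡⟨ cong (_+ descentsAfter y w) (bit-positive-split x y) ⟩
  bit (descent x y) + bit (proj₁ y ∧ not (descent x y)) + descentsAfter y w
    ≡⟨ xy∙z≈xz∙y (bit (descent x y)) _ (descentsAfter y w) ⟩
  bit (descent x y) + descentsAfter y w + bit (proj₁ y ∧ not (descent x y)) ∎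
descentsAfter-insert⁺ x (y ∷ w) (suc g) _ (y<N ∷ w<N) =
  trans (cong (_+_ (bit (descent x y))) (descentsAfter-insert⁺ y w g (descent-to-top y true y<N) w<N))
        (sym (ℕ.+-assoc (bit (descent x y)) _ _))

∑-newDescent : ∀ x w → descentsAfter x w + ∑ (suc (length w)) (newDescent x w) ≡ positives w
∑-newDescent x []            = refl
∑-newDescent x (y@(b , _) ∷ w) = begin
  bit (descent x y) + descentsAfter y w + (bit (b ∧ not (descent x y)) + ∑ (suc (length w)) (newDescent y w))
    ≡⟨ interchange (bit (descent x y)) (descentsAfter y w) _ _ ⟩
  bit (descent x y) + bit (b ∧ not (descent x y)) + (descentsAfter y w + ∑ (suc (length w)) (newDescent y w))
    ≡⟨ cong₂ _+_ (sym (bit-positive-split x y)) (∑-newDescent y w) ⟩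
  bit b + positives w ∎

-- Inserting a negative top letter between x and y destroys the descent x > y, if any.
lostDescent : Symbol → List Symbol → ℕ → ℕ
lostDescent x []      g       = 0
lostDescent x (y ∷ w) zero    = bit (descent x y)
lostDescent x (y ∷ w) (suc g) = lostDescent y w g

lostDescent≤1 : ∀ x w g → lostDescent x w g ≤ 1
lostDescent≤1 x []      g       = z≤n
lostDescent≤1 x (y ∷ w) zero    = bit≤1 (descent x y)
lostDescent≤1 x (y ∷ w) (suc g) = lostDescent≤1 y w g

descentsAfter-insert⁻ : ∀ N x w g → descentsAfter x (insert w g (false , N)) + lostDescent x w g ≡ descentsAfter x w
descentsAfter-insert⁻ N x []      zero    = cong (λ b → bit b + 0 + 0) (descent-to-negative x N)
descentsAfter-insert⁻ N x []      (suc g) = cong (λ b → bit b + 0 + 0) (descent-to-negative x N)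
descentsAfter-insert⁻ N x (y ∷ w) zero    =
  trans (cong (λ b → bit b + descentsAfter y w + bit (descent x y)) (descent-to-negative x N))
        (ℕ.+-comm (descentsAfter y w) _)
descentsAfter-insert⁻ N x (y ∷ w) (suc g) =
  trans (ℕ.+-assoc (bit (descent x y)) _ _) (cong (_+_ (bit (descent x y))) (descentsAfter-insert⁻ N y w g))

∑-lostDescent : ∀ x w → ∑ (suc (length w)) (lostDescent x w) ≡ descentsAfter x w
∑-lostDescent x []      = refl
∑-lostDescent x (y ∷ w) = cong (_+_ (bit (descent x y))) (∑-lostDescent y w)

∑-choose-+≤1 : ∀ n d s (e : ℕ → ℕ) → (∀ g → e g ≤ 1) →
  ∑ n (λ g → (d + e g) choose s) ≡ n * d choose s + ∑ n e * d choose⁻ s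
∑-choose-+≤1 n d s e e≤1 = begin
  ∑ n (λ g → (d + e g) choose s)                           ≡⟨ ∑-cong n (λ g _ → choose-+≤1 d (e g) s (e≤1 g)) ⟩
  ∑ n (λ g → d choose s + e g * d choose⁻ s)               ≡⟨ ∑-+ n (λ _ → d choose s) (λ g → e g * d choose⁻ s) ⟩
  ∑ n (λ _ → d choose s) + ∑ n (λ g → e g * d choose⁻ s)   ≡⟨ cong₂ _+_ (∑-const n (d choose s)) (∑-*ʳ n (d choose⁻ s) e) ⟩
  n * d choose s + ∑ n e * d choose⁻ s                     ∎

private
  rebalance : ∀ {N d q} s → d ≤ q → q ≤ N →
    suc N * d choose s + (q ∸ d) * d choose⁻ s ≡ (suc N ∸ s) * d choose s + (suc q ∸ s) * d choose⁻ s
  rebalance {N} {d} {q} s d≤q q≤N with s ≤? suc d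
  ... | yes s≤1+d = begin
    suc N * c + (q ∸ d) * c⁻                        ≡⟨ cong (λ x → x * c + (q ∸ d) * c⁻) (ℕ.m∸n+n≡m s≤1+N) ⟨
    (suc N ∸ s + s) * c + (q ∸ d) * c⁻              ≡⟨ regroup (suc N ∸ s) s c ((q ∸ d) * c⁻) ⟩
    (suc N ∸ s) * c + (s * c + (q ∸ d) * c⁻)        ≡⟨ cong (λ x → (suc N ∸ s) * c + (x + (q ∸ d) * c⁻)) (*-choose≡∸-*-choose⁻ d s) ⟩
    (suc N ∸ s) * c + ((suc d ∸ s) * c⁻ + (q ∸ d) * c⁻) ≡⟨ cong (_+_ ((suc N ∸ s) * c)) (ℕ.*-distribʳ-+ c⁻ (suc d ∸ s) (q ∸ d)) ⟨
    (suc N ∸ s) * c + (suc d ∸ s + (q ∸ d)) * c⁻    ≡⟨ cong (λ x → (suc N ∸ s) * c + x * c⁻) count ⟩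
    (suc N ∸ s) * c + (suc q ∸ s) * c⁻              ∎
    where
    c  = d choose s
    c⁻ = d choose⁻ s
    s≤1+N = ℕ.≤-trans s≤1+d (s≤s (ℕ.≤-trans d≤q q≤N))
    regroup : ∀ a b c x → (a + b) * c + x ≡ a * c + (b * c + x)
    regroup = solve-∀
    count : suc d ∸ s + (q ∸ d) ≡ suc q ∸ s
    count = trans (sym (ℕ.+-∸-comm (q ∸ d) s≤1+d)) (cong (_∸ s) (cong suc (ℕ.m+[n∸m]≡n d≤q)))
  ... | no s≰1+d = begin
    suc N * c + (q ∸ d) * c⁻                ≡⟨ cong₂ (λ x y → suc N * x + (q ∸ d) * y) c≡0 c⁻≡0 ⟩
    suc N * 0 + (q ∸ d) * 0                 ≡⟨ cong₂ _+_ (ℕ.*-zeroʳ (suc N)) (ℕ.*-zeroʳ (q ∸ d)) ⟩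
    0                                       ≡⟨ cong₂ _+_ (ℕ.*-zeroʳ (suc N ∸ s)) (ℕ.*-zeroʳ (suc q ∸ s)) ⟨
    (suc N ∸ s) * 0 + (suc q ∸ s) * 0       ≡⟨ cong₂ (λ x y → (suc N ∸ s) * x + (suc q ∸ s) * y) c≡0 c⁻≡0 ⟨
    (suc N ∸ s) * c + (suc q ∸ s) * c⁻      ∎
    where
    c  = d choose s
    c⁻ = d choose⁻ s
    1+d<s = ℕ.≰⇒> s≰1+d
    c≡0 : c ≡ 0
    c≡0 = choose-vanish (ℕ.<-trans (ℕ.n<1+n d) 1+d<s)
    c⁻≡0 : c⁻ ≡ 0
    c⁻≡0 = choose⁻-vanish 1+d<s

  cancel-absorbed : ∀ {N d} s X → d ≤ N → X + d * (d ∸ 1) choose⁻ s ≡ suc N * d choose s → X ≡ (suc N ∸ s) * d choose s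
  cancel-absorbed {N} {d} s X d≤N eq with s ≤? suc N
  ... | yes s≤1+N = ℕ.+-cancelʳ-≡ (s * d choose s) X ((suc N ∸ s) * d choose s) (begin
    X + s * d choose s                   ≡⟨ cong (_+_ X) (*-choose⁻≡*-choose d s) ⟨
    X + d * (d ∸ 1) choose⁻ s            ≡⟨ eq ⟩
    suc N * d choose s                   ≡⟨ cong (_* d choose s) (ℕ.m∸n+n≡m s≤1+N) ⟨
    (suc N ∸ s + s) * d choose s         ≡⟨ ℕ.*-distribʳ-+ (d choose s) (suc N ∸ s) s ⟩
    (suc N ∸ s) * d choose s + s * d choose s ∎)
  ... | no s≰1+N = begin
    X                                    ≡⟨ ℕ.+-identityʳ X ⟨
    X + 0                                ≡⟨ cong (_+_ X) (trans (*-choose⁻≡*-choose d s) (trans (cong (s *_) c≡0) (ℕ.*-zeroʳ s))) ⟨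
    X + d * (d ∸ 1) choose⁻ s            ≡⟨ eq ⟩
    suc N * d choose s                   ≡⟨ cong (suc N *_) c≡0 ⟩
    suc N * 0                            ≡⟨ ℕ.*-zeroʳ (suc N) ⟩
    0                                    ≡⟨ ℕ.*-zeroʳ (suc N ∸ s) ⟨
    (suc N ∸ s) * 0                      ≡⟨ cong ((suc N ∸ s) *_) c≡0 ⟨
    (suc N ∸ s) * d choose s             ∎
    where
    c≡0 : d choose s ≡ 0
    c≡0 = choose-vanish (ℕ.<-trans (s≤s d≤N) (ℕ.≰⇒> s≰1+N))

  shrink : ∀ n e s → e ≤ 1 → e * n choose⁻ s ≡ e * (n + e ∸ 1) choose⁻ s
  shrink n .0 s z≤n       = refl
  shrink n .1 s (s≤s z≤n) = cong (λ m → 1 * m choose⁻ s) (sym (ℕ.m+n∸n≡m n 1))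

∑-choose-insert⁺ : ∀ {N} x w s → descent x (true , N) ≡ false → ListAll.All (Below N) w → length w ≡ N →
  ∑ (suc N) (λ g → descentsAfter x (insert w g (true , N)) choose s)
    ≡ (suc N ∸ s) * descentsAfter x w choose s + (suc (positives w) ∸ s) * descentsAfter x w choose⁻ s
∑-choose-insert⁺ {N} x w s x↛N w<N refl = begin
  ∑ (suc N) (λ g → descentsAfter x (insert w g (true , N)) choose s)
    ≡⟨ ∑-cong (suc N) (λ g _ → cong (_choose s) (descentsAfter-insert⁺ x w g x↛N w<N)) ⟩
  ∑ (suc N) (λ g → (d + newDescent x w g) choose s)
    ≡⟨ ∑-choose-+≤1 (suc N) d s (newDescent x w) (newDescent≤1 x w) ⟩
  suc N * d choose s + ∑ (suc N) (newDescent x w) * d choose⁻ s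
    ≡⟨ cong (λ k → suc N * d choose s + k * d choose⁻ s) (trans (sym (ℕ.m+n∸m≡n d _)) (cong (_∸ d) (∑-newDescent x w))) ⟩
  suc N * d choose s + (positives w ∸ d) * d choose⁻ s
    ≡⟨ rebalance s (descentsAfter≤positives x w) (positives≤length w) ⟩
  (suc N ∸ s) * d choose s + (suc (positives w) ∸ s) * d choose⁻ s ∎
  where
  d = descentsAfter x w

∑-choose-insert⁻ : ∀ {N} x w s → length w ≡ N →
  ∑ (suc N) (λ g → descentsAfter x (insert w g (false , N)) choose s) ≡ (suc N ∸ s) * descentsAfter x w choose s
∑-choose-insert⁻ {N} x w s refl = cancel-absorbed s _ (ℕ.≤-trans (descentsAfter≤positives x w) (positives≤length w)) (begin
  ∑ (suc N) (λ g → d′ g choose s) + d * (d ∸ 1) choose⁻ s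
    ≡⟨ cong (λ k → ∑ (suc N) (λ g → d′ g choose s) + k * (d ∸ 1) choose⁻ s) (∑-lostDescent x w) ⟨
  ∑ (suc N) (λ g → d′ g choose s) + ∑ (suc N) e * (d ∸ 1) choose⁻ s
    ≡⟨ cong (_+_ (∑ (suc N) (λ g → d′ g choose s))) (∑-*ʳ (suc N) ((d ∸ 1) choose⁻ s) e) ⟨
  ∑ (suc N) (λ g → d′ g choose s) + ∑ (suc N) (λ g → e g * (d ∸ 1) choose⁻ s)
    ≡⟨ ∑-+ (suc N) (λ g → d′ g choose s) (λ g → e g * (d ∸ 1) choose⁻ s) ⟨
  ∑ (suc N) (λ g → d′ g choose s + e g * (d ∸ 1) choose⁻ s)
    ≡⟨ ∑-cong (suc N) (λ g _ → pointwise g) ⟩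
  ∑ (suc N) (λ _ → d choose s)
    ≡⟨ ∑-const (suc N) (d choose s) ⟩
  suc N * d choose s ∎)
  where
  d = descentsAfter x w
  d′ = λ g → descentsAfter x (insert w g (false , N))
  e = lostDescent x w
  pointwise : ∀ g → d′ g choose s + e g * (d ∸ 1) choose⁻ s ≡ d choose s
  pointwise g = begin
    d′ g choose s + e g * (d ∸ 1) choose⁻ s       ≡⟨ cong (λ k → d′ g choose s + e g * (k ∸ 1) choose⁻ s) (descentsAfter-insert⁻ N x w g) ⟨
    d′ g choose s + e g * (d′ g + e g ∸ 1) choose⁻ s ≡⟨ cong (_+_ (d′ g choose s)) (shrink (d′ g) (e g) s (lostDescent≤1 x w g)) ⟨
    d′ g choose s + e g * d′ g choose⁻ s          ≡⟨ choose-+≤1 (d′ g) (e g) s (lostDescent≤1 x w g) ⟨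
    (d′ g + e g) choose s                         ≡⟨ cong (_choose s) (descentsAfter-insert⁻ N x w g) ⟩
    d choose s                                    ∎

-- Signed permutations as insertions of a largest letter

module _ {a} {A : Set a} where

  All-insertAt⁺ : ∀ {p} {P : A → Set p} {k} {v : Vec A k} {y} → All P v → P y → ∀ g → All P (insertAt v g y)
  All-insertAt⁺ pv         py zero    = py ∷ pv
  All-insertAt⁺ (px ∷ pv)  py (suc g) = px ∷ All-insertAt⁺ pv py g

  All-removeAt⁺ : ∀ {p} {P : A → Set p} {k} {v : Vec A (suc k)} → All P v → ∀ g → All P (removeAt v g)
  All-removeAt⁺ (px ∷ pv)                 zero    = pv
  All-removeAt⁺ {v = _ ∷ _ ∷ _} (px ∷ pv) (suc g) = px ∷ All-removeAt⁺ pv g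

  Unique-insertAt⁺ : ∀ {k} {v : Vec A k} {y} → Unique v → All (y ≢_) v → ∀ g → Unique (insertAt v g y)
  Unique-insertAt⁺ uv           y∉v        zero    = y∉v ∷ uv
  Unique-insertAt⁺ (x∉v ∷ uv)   (y≢x ∷ y∉v) (suc g) = All-insertAt⁺ x∉v (y≢x ∘ sym) g ∷ Unique-insertAt⁺ uv y∉v g

  Unique-removeAt⁺ : ∀ {k} {v : Vec A (suc k)} → Unique v → ∀ g → Unique (removeAt v g)
  Unique-removeAt⁺ (_ ∷ uv)                  zero    = uv
  Unique-removeAt⁺ {v = _ ∷ _ ∷ _} (x∉v ∷ uv) (suc g) = All-removeAt⁺ x∉v g ∷ Unique-removeAt⁺ uv g

  removeAt-≢-lookup : ∀ {k} (v : Vec A (suc k)) g → Unique v → All (_≢ lookup v g) (removeAt v g)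
  removeAt-≢-lookup (x ∷ v)     zero    (x∉v ∷ _)  = All.map (_∘ sym) x∉v
  removeAt-≢-lookup (x ∷ y ∷ v) (suc g) (x∉v ∷ uv) = All.lookup⁺ x∉v g ∷ removeAt-≢-lookup (y ∷ v) g uv

  map-removeAt : ∀ {b} {B : Set b} (f : A → B) {k} (v : Vec A (suc k)) g → map f (removeAt v g) ≡ removeAt (map f v) g
  map-removeAt f (x ∷ v)     zero    = refl
  map-removeAt f (x ∷ y ∷ v) (suc g) = cong (f x ∷_) (map-removeAt f (y ∷ v) g)

  map-injective : ∀ {b} {B : Set b} {f : A → B} → (∀ {x y} → f x ≡ f y → x ≡ y) →
    ∀ {k} {v w : Vec A k} → map f v ≡ map f w → v ≡ w
  map-injective f-inj {v = []}    {[]}    _  = refl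
  map-injective f-inj {v = x ∷ v} {y ∷ w} eq = cong₂ _∷_ (f-inj (Vec.∷-injectiveˡ eq)) (map-injective f-inj (Vec.∷-injectiveʳ eq))

  Unique-map⁻ : ∀ {b} {B : Set b} (f : A → B) {k} {v : Vec A k} → Unique (map f v) → Unique v
  Unique-map⁻ f {v = []}    _          = []
  Unique-map⁻ f {v = x ∷ v} (fx∉ ∷ u) = All.map (_∘ cong f) (All.map⁻ fx∉) ∷ Unique-map⁻ f u

signedPerm-≡ : ∀ {n} {π π′ : SignedPerm n} → word π ≡ word π′ → π ≡ π′
signedPerm-≡ {π = sperm w _} {sperm .w _} refl = refl

values : ∀ {n k} → Vec (Letter n) k → Vec (Fin n) k
values = map proj₂

-- Distinctness is decidable, so its irrelevant proof can be recomputed.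
distinct′ : ∀ {n} (π : SignedPerm n) → Unique (values (word π))
distinct′ (sperm w p) = recompute (allPairs? (λ x y → ¬? (x Fin.≟ y)) (values w)) p

lift : ∀ {n} → Letter n → Letter (suc n)
lift = map₂ inject₁

values-map-lift : ∀ {n k} (v : Vec (Letter n) k) → values (map lift v) ≡ map inject₁ (values v)
values-map-lift v = trans (sym (Vec.map-∘ proj₂ lift v)) (Vec.map-∘ inject₁ proj₂ v)

insertTopLetter : ∀ {n k} → Vec (Letter n) k → Fin (suc k) → Bool → Vec (Letter (suc n)) (suc k)
insertTopLetter {n} v g b = insertAt (map lift v) g (b , fromℕ n)

values-insertTopLetter : ∀ {n k} (v : Vec (Letter n) k) g b →
  values (insertTopLetter v g b) ≡ insertAt (map inject₁ (values v)) g (fromℕ n)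
values-insertTopLetter {n} v g b =
  trans (Vec.map-insertAt proj₂ (b , fromℕ n) (map lift v) g) (cong (λ u → insertAt u g (fromℕ n)) (values-map-lift v))

Unique-insertTopLetter : ∀ {n k} (v : Vec (Letter n) k) g b → Unique (values v) → Unique (values (insertTopLetter v g b))
Unique-insertTopLetter v g b u = subst Unique (sym (values-insertTopLetter v g b))
  (Unique-insertAt⁺ (Unique.map⁺ Fin.inject₁-injective u) (All.map⁺ (All.universal (λ _ → Fin.fromℕ≢inject₁) _)) g)

insertTop : ∀ {n} → SignedPerm n → Fin (suc n) × Bool → SignedPerm (suc n)
insertTop π (g , b) = sperm (insertTopLetter (word π) g b) (Unique-insertTopLetter (word π) g b (distinct′ π))

insertTop-injective : ∀ {n} {π π′ : SignedPerm n} {g g′ b b′} →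
  insertTop π (g , b) ≡ insertTop π′ (g′ , b′) → π ≡ π′ × (g , b) ≡ (g′ , b′)
insertTop-injective {n} {π} {π′} {g} {g′} {b} {b′} eq =
  signedPerm-≡ words , cong₂ _,_ g≡g′ (cong proj₁ (trans (sym at-g) (trans (cong (lookup w) g≡g′) at-g′)))
  where
  w = insertTopLetter (word π) g b
  eqw : w ≡ insertTopLetter (word π′) g′ b′
  eqw = cong word eq
  at-g : lookup w g ≡ (b , fromℕ n)
  at-g = Vec.insertAt-lookup (map lift (word π)) g (b , fromℕ n)
  at-g′ : lookup w g′ ≡ (b′ , fromℕ n)
  at-g′ = trans (cong (λ u → lookup u g′) eqw) (Vec.insertAt-lookup (map lift (word π′)) g′ (b′ , fromℕ n))
  g≡g′ : g ≡ g′
  g≡g′ = Unique.lookup-injective (Unique-insertTopLetter (word π) g b (distinct′ π)) g g′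
           (trans (Vec.lookup-map g proj₂ w) (trans (trans (cong proj₂ at-g) (sym (cong proj₂ at-g′))) (sym (Vec.lookup-map g′ proj₂ w))))
  words : word π ≡ word π′
  words = map-injective (λ {x} {y} → lift-injective {x = x} {y}) (begin
    map lift (word π)                         ≡⟨ Vec.removeAt-insertAt (map lift (word π)) g _ ⟨
    removeAt w g                              ≡⟨ cong (λ u → removeAt u g) eqw ⟩
    removeAt (insertTopLetter (word π′) g′ b′) g ≡⟨ cong (λ h → removeAt (insertTopLetter (word π′) h b′) g) g≡g′ ⟨
    removeAt (insertTopLetter (word π′) g b′) g  ≡⟨ Vec.removeAt-insertAt (map lift (word π′)) g _ ⟩
    map lift (word π′)                        ∎)
    where
    open ≡-Reasoning
    lift-injective : ∀ {x y : Letter n} → lift x ≡ lift y → x ≡ y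
    lift-injective {_ , _} {_ , _} e = cong₂ _,_ (cong proj₁ e) (Fin.inject₁-injective (cong proj₂ e))

occurs? : ∀ {n k} (v : Vec (Fin n) k) y → (∃ λ g → lookup v g ≡ y) ⊎ All (_≢ y) v
occurs? []      y = inj₂ []
occurs? (x ∷ v) y with x Fin.≟ y | occurs? v y
... | yes x≡y | _               = inj₁ (zero , x≡y)
... | no  x≢y | inj₁ (g , v[g]) = inj₁ (suc g , v[g])
... | no  x≢y | inj₂ y∉v        = inj₂ (x≢y ∷ y∉v)

≢fromℕ⇒≢toℕ : ∀ {n} {a : Fin (suc n)} → a ≢ fromℕ n → n ≢ toℕ a
≢fromℕ⇒≢toℕ {n} a≢n n≡a = a≢n (Fin.toℕ-injective (trans (sym n≡a) (sym (Fin.toℕ-fromℕ n))))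

-- Otherwise lowering the n + 1 distinct entries would inject Fin (suc n) into Fin n.
fromℕ-occurs : ∀ {n} (u : Vec (Fin (suc n)) (suc n)) → Unique u → ∃ λ g → lookup u g ≡ fromℕ n
fromℕ-occurs {n} u uu with occurs? u (fromℕ n)
... | inj₁ found = found
... | inj₂ n∉u   =
  let i , j , i<j , same = Fin.pigeonhole ℕ.≤-refl (λ i → lower₁ (lookup u i) (n≢ i))
      i≡j = Unique.lookup-injective uu i j (trans (sym (Fin.inject₁-lower₁ (lookup u i) (n≢ i)))
                                           (trans (cong inject₁ same) (Fin.inject₁-lower₁ (lookup u j) (n≢ j))))
  in ⊥-elim (ℕ.<-irrefl (cong toℕ i≡j) i<j)
  where
  n≢ : ∀ i → n ≢ toℕ (lookup u i)
  n≢ i = ≢fromℕ⇒≢toℕ (All.lookup⁺ n∉u i)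

lowerLetters : ∀ {n k} (v : Vec (Letter (suc n)) k) → All (λ x → proj₂ x ≢ fromℕ n) v → Vec (Letter n) k
lowerLetters []            []           = []
lowerLetters ((b , a) ∷ v) (a≢n ∷ v≢n) = (b , lower₁ a (≢fromℕ⇒≢toℕ a≢n)) ∷ lowerLetters v v≢n

map-lift-lowerLetters : ∀ {n k} (v : Vec (Letter (suc n)) k) v≢n → map lift (lowerLetters v v≢n) ≡ v
map-lift-lowerLetters []            []           = refl
map-lift-lowerLetters ((b , a) ∷ v) (a≢n ∷ v≢n) =
  cong₂ _∷_ (cong (b ,_) (Fin.inject₁-lower₁ a _)) (map-lift-lowerLetters v v≢n)

insertTop-surjective : ∀ {n} (τ : SignedPerm (suc n)) → ∃₂ λ π slot → insertTop π slot ≡ τ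
insertTop-surjective {n} τ@(sperm w _) = sperm v (Unique-map⁻ inject₁ values-v) , (g , proj₁ (lookup w g)) , signedPerm-≡ reinsert
  where
  uw = distinct′ τ
  found = fromℕ-occurs (values w) uw
  g = proj₁ found
  top : proj₂ (lookup w g) ≡ fromℕ n
  top = trans (sym (Vec.lookup-map g proj₂ w)) (proj₂ found)
  rest≢n : All (λ x → proj₂ x ≢ fromℕ n) (removeAt w g)
  rest≢n = All.map⁻ (subst (All (_≢ fromℕ n)) (sym (map-removeAt proj₂ w g))
                     (subst (λ y → All (_≢ y) (removeAt (values w) g)) (proj₂ found) (removeAt-≢-lookup (values w) g uw)))
  v = lowerLetters (removeAt w g) rest≢n
  lift-v : map lift v ≡ removeAt w g
  lift-v = map-lift-lowerLetters (removeAt w g) rest≢n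
  values-v : Unique (map inject₁ (values v))
  values-v = subst Unique (trans (sym (map-removeAt proj₂ w g)) (trans (cong values (sym lift-v)) (values-map-lift v))) (Unique-removeAt⁺ uw g)
  reinsert : insertTopLetter v g (proj₁ (lookup w g)) ≡ w
  reinsert = trans (cong₂ (λ u x → insertAt u g (proj₁ (lookup w g) , x)) lift-v (sym top)) (Vec.insertAt-removeAt w g)

toSymbol : ∀ {n} → Letter n → Symbol
toSymbol (b , a) = b , toℕ a

symbols : ∀ {n k} → Vec (Letter n) k → List Symbol
symbols []      = []
symbols (x ∷ v) = toSymbol x ∷ symbols v

length-symbols : ∀ {n k} (v : Vec (Letter n) k) → length (symbols v) ≡ k
length-symbols []      = refl
length-symbols (x ∷ v) = cong suc (length-symbols v)

symbols-Below : ∀ {n k} (v : Vec (Letter n) k) → ListAll.All (Below n) (symbols v)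
symbols-Below []            = []
symbols-Below ((b , a) ∷ v) = Fin.toℕ<n a ∷ symbols-Below v

symbols-insertTopLetter : ∀ {n k} (v : Vec (Letter n) k) g b → symbols (insertTopLetter v g b) ≡ insert (symbols v) (toℕ g) (b , n)
symbols-insertTopLetter {n} v zero b = cong₂ _∷_ (cong (b ,_) (Fin.toℕ-fromℕ n)) (symbols-map-lift v)
  where
  symbols-map-lift : ∀ {k} (v : Vec (Letter n) k) → symbols (map lift v) ≡ symbols v
  symbols-map-lift []            = refl
  symbols-map-lift ((c , a) ∷ v) = cong₂ _∷_ (cong (c ,_) (Fin.toℕ-inject₁ a)) (symbols-map-lift v)
symbols-insertTopLetter ((c , a) ∷ v) (suc g) b = cong₂ _∷_ (cong (c ,_) (Fin.toℕ-inject₁ a)) (symbols-insertTopLetter v g b)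

-- A negative letter never starts a positive descent, so the prefix (false , 0) adds none.
posDes-descentsAfter : ∀ {n} (π : SignedPerm n) → posDes π ≡ descentsAfter (false , 0) (symbols (word π))
posDes-descentsAfter π = countAdj≡ (word π)
  where
  isPosDesc≡ : ∀ {n} (x y : Letter n) → isPosDesc x y ≡ descent (toSymbol x) (toSymbol y)
  isPosDesc≡ (true  , _) (true  , _) = refl
  isPosDesc≡ (true  , _) (false , _) = refl
  isPosDesc≡ (false , _) (_     , _) = refl
  countAdj≡ : ∀ {n k} (v : Vec (Letter n) k) → countAdj isPosDesc v ≡ descentsAfter (false , 0) (symbols v)
  countAdj≡ []          = refl
  countAdj≡ (x ∷ [])    = refl
  countAdj≡ (x ∷ y ∷ v) = cong₂ (λ b d → bit b + d) (isPosDesc≡ x y) (countAdj≡ (y ∷ v))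

positiveLetters : ∀ {n} → SignedPerm n → ℕ
positiveLetters π = positives (symbols (word π))

posDes≤positiveLetters : ∀ {n} (π : SignedPerm n) → posDes π ≤ positiveLetters π
posDes≤positiveLetters π = subst (_≤ positiveLetters π) (sym (posDes-descentsAfter π)) (descentsAfter≤positives (false , 0) (symbols (word π)))

positiveLetters≤n : ∀ {n} (π : SignedPerm n) → positiveLetters π ≤ n
positiveLetters≤n π = subst (positiveLetters π ≤_) (length-symbols (word π)) (positives≤length (symbols (word π)))

posDes≤n : ∀ {n} (π : SignedPerm n) → posDes π ≤ n
posDes≤n π = ℕ.≤-trans (posDes≤positiveLetters π) (positiveLetters≤n π)

signs : List Bool
signs = true ∷ false ∷ []

slots : ∀ n → List (Fin (suc n) × Bool)
slots n = cartesianProduct (allFin (suc n)) signs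

signedPerms : ∀ n → List (SignedPerm n)
signedPerms zero    = sperm [] [] ∷ []
signedPerms (suc n) = cartesianProductWith insertTop (signedPerms n) (slots n)

∈-signedPerms : ∀ {n} (π : SignedPerm n) → π ∈ signedPerms n
∈-signedPerms {zero}  (sperm [] _) = here refl
∈-signedPerms {suc n} τ =
  let π , (g , b) , π↦τ = insertTop-surjective τ
  in subst (_∈ signedPerms (suc n)) π↦τ
       (∈.∈-cartesianProductWith⁺ insertTop (∈-signedPerms π) (∈.∈-cartesianProduct⁺ (∈.∈-allFin g) (∈-signs b)))
  where
  ∈-signs : ∀ b → b ∈ signs
  ∈-signs true  = here refl
  ∈-signs false = there (here refl)

signedPerms-unique : ∀ n → UniqueList (signedPerms n)
signedPerms-unique zero    = [] ∷ []
signedPerms-unique (suc n) = UniqueList.cartesianProductWith⁺ insertTop insertTop-injective (signedPerms-unique n)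
  (UniqueList.cartesianProduct⁺ (UniqueList.allFin⁺ (suc n)) (((λ ()) ∷ []) ∷ [] ∷ []))

index-∈-lookup : ∀ {a} {A : Set a} (xs : List A) i → index (∈.∈-lookup {xs = xs} i) ≡ i
index-∈-lookup (x ∷ xs) zero    = refl
index-∈-lookup (x ∷ xs) (suc i) = cong suc (index-∈-lookup xs i)

module _ {a p} {A : Set a} {P : A → Set p} (P? : Decidable P) (P-irrelevant : ∀ {x} (p q : P x) → p ≡ q)
         {xs : List A} (complete : ∀ x → x ∈ xs) (unique : UniqueList xs) where

  Σ↔Fin-length-filter : Σ A P ↔ Fin (length (filter P? xs))
  Σ↔Fin-length-filter = mk↔ₛ′ to from to∘from from∘to
    where
    ys = filter P? xs
    to : Σ A P → Fin (length ys)
    to (x , px) = index (∈.∈-filter⁺ P? (complete x) px)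
    from : Fin (length ys) → Σ A P
    from i = List.lookup ys i , proj₂ (∈.∈-filter⁻ P? {xs = xs} (∈.∈-lookup i))
    to∘from : ∀ i → to (from i) ≡ i
    to∘from i = trans (cong index (unique⇒irrelevant (UniqueList.filter⁺ P? unique) _ _)) (index-∈-lookup ys i)
    from∘to : ∀ y → from (to y) ≡ y
    from∘to (x , px) = Σ-≡ (sym (Any.lookup-index (∈.∈-filter⁺ P? (complete x) px)))
      where
      Σ-≡ : ∀ {y} {py : P y} → y ≡ x → (y , py) ≡ (x , px)
      Σ-≡ refl = cong (x ,_) (P-irrelevant _ _)

length-filter-≟ : ∀ {a} {A : Set a} (f : A → ℕ) m (xs : List A) → length (filter (λ x → f x ℕ.≟ m) xs) ≡ ∑ᴸ xs (λ x → δ (f x) m)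
length-filter-≟ f m []       = refl
length-filter-≟ f m (x ∷ xs) with f x ℕ.≟ m
... | yes fx≡m = trans (cong length (filter-accept (λ x → f x ℕ.≟ m) fx≡m))
                       (cong₂ _+_ (sym (trans (cong (λ k → δ k m) fx≡m) (δ-refl m))) (length-filter-≟ f m xs))
... | no  fx≢m = trans (cong length (filter-reject (λ x → f x ℕ.≟ m) fx≢m))
                       (cong₂ _+_ (sym (δ-≢ fx≢m)) (length-filter-≟ f m xs))

negateLetters : ∀ {n k} → Vec (Letter n) k → Vec (Letter n) k
negateLetters = map (map₁ not)

negate : ∀ {n} → SignedPerm n → SignedPerm n
negate π = sperm (negateLetters (word π)) (subst Unique (Vec.map-∘ proj₂ (map₁ not) (word π)) (distinct′ π))

negate-involutive : ∀ {n} (π : SignedPerm n) → negate (negate π) ≡ π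
negate-involutive π = signedPerm-≡ (begin
  map (map₁ not) (map (map₁ not) (word π)) ≡⟨ Vec.map-∘ (map₁ not) (map₁ not) (word π) ⟨
  map (map₁ not ∘ map₁ not) (word π)       ≡⟨ Vec.map-cong (λ x → cong (_, proj₂ x) (Bool.not-involutive (proj₁ x))) (word π) ⟩
  map id (word π)                          ≡⟨ Vec.map-id (word π) ⟩
  word π                                   ∎)
  where
  open ≡-Reasoning

posDes-negate : ∀ {n} (π : SignedPerm n) → posDes (negate π) ≡ negDes π
posDes-negate π = countAdj-negate (word π)
  where
  isPosDesc-negate : ∀ {n} (x y : Letter n) → isPosDesc (map₁ not x) (map₁ not y) ≡ isNegDesc x y
  isPosDesc-negate (true  , _) (_     , _) = refl
  isPosDesc-negate (false , _) (true  , _) = refl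
  isPosDesc-negate (false , _) (false , _) = refl
  countAdj-negate : ∀ {n k} (v : Vec (Letter n) k) → countAdj isPosDesc (negateLetters v) ≡ countAdj isNegDesc v
  countAdj-negate []          = refl
  countAdj-negate (x ∷ [])    = refl
  countAdj-negate (x ∷ y ∷ v) = cong₂ (λ b d → (if b then 1 else 0) + d) (isPosDesc-negate x y) (countAdj-negate (y ∷ v))

WithNegDes↔WithPosDes : ∀ n m → WithNegDes n m ↔ WithPosDes n m
WithNegDes↔WithPosDes n m = mk↔ₛ′ (λ (π , d) → negate π , trans (posDes-negate π) d)
                                  (λ (π , d) → negate π , trans (sym (posDes-negate (negate π))) (trans (cong posDes (negate-involutive π)) d))
                                  (λ (π , d) → Σ-≡ (negate-involutive π))
                                  (λ (π , d) → Σ-≡ (negate-involutive π))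
  where
  Σ-≡ : ∀ {f : SignedPerm n → ℕ} {π π′} {d : f π ≡ m} {d′ : f π′ ≡ m} → π ≡ π′ → (π , d) ≡ (π′ , d′)
  Σ-≡ refl = cong (_ ,_) (ℕ.≡-irrelevant _ _)

-- Binomial moments of the descent number

descentMoment : ℕ → ℕ → ℕ → ℕ
descentMoment n s p = ∑ᴸ (signedPerms n) (λ π → δ (positiveLetters π) p * posDes π choose s)

∑-slots-insertTop : ∀ {n} (π : SignedPerm n) s p →
  let q = positiveLetters π
      d = posDes π
  in ∑ᴸ (slots n) (λ slot → δ (positiveLetters (insertTop π slot)) p * posDes (insertTop π slot) choose s)
     ≡ δ (suc q) p * ((suc n ∸ s) * d choose s + (suc q ∸ s) * d choose⁻ s) + δ q p * ((suc n ∸ s) * d choose s)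
∑-slots-insertTop {n} π s p = begin
  ∑ᴸ (slots n) F
    ≡⟨ ∑ᴸ-cartesianProductWith _,_ (allFin (suc n)) signs F ⟩
  ∑ᴸ (allFin (suc n)) (λ g → F (g , true) + (F (g , false) + 0))
    ≡⟨ ∑ᴸ-tabulate (suc n) id _ (λ g → h true g + h false g) (λ g → cong₂ _+_ (at g true) (trans (ℕ.+-identityʳ _) (at g false))) ⟩
  ∑ (suc n) (λ g → h true g + h false g)
    ≡⟨ trans (∑-+ (suc n) (h true) (h false)) (cong₂ _+_ (∑-*ˡ (suc n) (δ (suc q) p) (c true)) (∑-*ˡ (suc n) (δ q p) (c false))) ⟩
  δ (suc q) p * ∑ (suc n) (c true) + δ q p * ∑ (suc n) (c false)
    ≡⟨ cong₂ (λ x y → δ (suc q) p * x + δ q p * y)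
             (∑-choose-insert⁺ (false , 0) w s refl (symbols-Below (word π)) (length-symbols (word π)))
             (∑-choose-insert⁻ (false , 0) w s (length-symbols (word π))) ⟩
  δ (suc q) p * ((suc n ∸ s) * d choose s + (suc q ∸ s) * d choose⁻ s) + δ q p * ((suc n ∸ s) * d choose s)
    ≡⟨ cong (λ d → δ (suc q) p * ((suc n ∸ s) * d choose s + (suc q ∸ s) * d choose⁻ s) + δ q p * ((suc n ∸ s) * d choose s))
            (posDes-descentsAfter π) ⟨
  δ (suc q) p * ((suc n ∸ s) * posDes π choose s + (suc q ∸ s) * posDes π choose⁻ s) + δ q p * ((suc n ∸ s) * posDes π choose s) ∎
  where
  w = symbols (word π)
  q = positiveLetters π
  d = descentsAfter (false , 0) w
  F : Fin (suc n) × Bool → ℕ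
  F slot = δ (positiveLetters (insertTop π slot)) p * posDes (insertTop π slot) choose s
  c : Bool → ℕ → ℕ
  c b g = descentsAfter (false , 0) (insert w g (b , n)) choose s
  h : Bool → ℕ → ℕ
  h b g = δ (bit b + q) p * c b g
  at : ∀ g b → F (g , b) ≡ h b (toℕ g)
  at g b = cong₂ (λ x y → δ x p * y choose s)
    (trans (cong positives (symbols-insertTopLetter (word π) g b)) (positives-insert w (toℕ g) b n))
    (trans (posDes-descentsAfter (insertTop π (g , b))) (cong (descentsAfter (false , 0)) (symbols-insertTopLetter (word π) g b)))

descentMoment⁻ : ℕ → ℕ → ℕ → ℕ
descentMoment⁻ n zero    p = 0
descentMoment⁻ n (suc s) p = descentMoment n s p

∑-choose⁻ : ∀ n s p → ∑ᴸ (signedPerms n) (λ π → δ (positiveLetters π) p * posDes π choose⁻ s) ≡ descentMoment⁻ n s p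
∑-choose⁻ n zero    p = ∑ᴸ-zero (signedPerms n) (λ π → ℕ.*-zeroʳ (δ (positiveLetters π) p))
∑-choose⁻ n (suc s) p = refl

momentTerm₁ momentTerm₂ : ℕ → ℕ → ℕ → ℕ
momentTerm₁ n s zero    = 0
momentTerm₁ n s (suc p) = (suc n ∸ s) * descentMoment n s p
momentTerm₂ n s zero    = 0
momentTerm₂ n s (suc p) = (suc p ∸ s) * descentMoment⁻ n s p

descentMoment-rec : ∀ n s p →
  descentMoment (suc n) s p ≡ momentTerm₁ n s p + momentTerm₂ n s p + (suc n ∸ s) * descentMoment n s p
descentMoment-rec n s p = begin
  ∑ᴸ (signedPerms (suc n)) (term p)
    ≡⟨ ∑ᴸ-cartesianProductWith insertTop Bₙ (slots n) (term p) ⟩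
  ∑ᴸ Bₙ (λ π → ∑ᴸ (slots n) (λ slot → term p (insertTop π slot)))
    ≡⟨ trans (∑ᴸ-cong Bₙ (λ π → ∑-slots-insertTop π s p)) (∑ᴸ-+ Bₙ (grown p) kept) ⟩
  ∑ᴸ Bₙ (grown p) + ∑ᴸ Bₙ kept
    ≡⟨ cong₂ _+_ (∑-grown p) (trans (∑ᴸ-cong Bₙ (λ π → x*[y*z]≡y*[x*z] (δ (q π) p) (suc n ∸ s) (c π)))
                                    (∑ᴸ-*ˡ Bₙ (suc n ∸ s) (term p))) ⟩
  momentTerm₁ n s p + momentTerm₂ n s p + (suc n ∸ s) * descentMoment n s p ∎
  where
  Bₙ = signedPerms n
  q c c⁻ : SignedPerm n → ℕ
  q = positiveLetters
  c π = posDes π choose s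
  c⁻ π = posDes π choose⁻ s
  term : ∀ {k} → ℕ → SignedPerm k → ℕ
  term p π = δ (positiveLetters π) p * posDes π choose s
  grown : ℕ → SignedPerm n → ℕ
  grown p π = δ (suc (q π)) p * ((suc n ∸ s) * c π + (suc (q π) ∸ s) * c⁻ π)
  kept : SignedPerm n → ℕ
  kept π = δ (q π) p * ((suc n ∸ s) * c π)
  distribute : ∀ δ a c b c⁻ → δ * (a * c + b * c⁻) ≡ a * (δ * c) + b * (δ * c⁻)
  distribute = solve-∀
  ∑-grown : ∀ p → ∑ᴸ Bₙ (grown p) ≡ momentTerm₁ n s p + momentTerm₂ n s p
  ∑-grown zero    = ∑ᴸ-zero Bₙ (λ _ → refl)
  ∑-grown (suc p) = begin
    ∑ᴸ Bₙ (λ π → δ (q π) p * ((suc n ∸ s) * c π + (suc (q π) ∸ s) * c⁻ π))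
      ≡⟨ ∑ᴸ-cong Bₙ (λ π → δ-subst (q π) p (λ k → (suc n ∸ s) * c π + (suc k ∸ s) * c⁻ π)) ⟩
    ∑ᴸ Bₙ (λ π → δ (q π) p * ((suc n ∸ s) * c π + (suc p ∸ s) * c⁻ π))
      ≡⟨ ∑ᴸ-cong Bₙ (λ π → distribute (δ (q π) p) (suc n ∸ s) (c π) (suc p ∸ s) (c⁻ π)) ⟩
    ∑ᴸ Bₙ (λ π → (suc n ∸ s) * term p π + (suc p ∸ s) * (δ (q π) p * c⁻ π))
      ≡⟨ ∑ᴸ-+ Bₙ (λ π → (suc n ∸ s) * term p π) (λ π → (suc p ∸ s) * (δ (q π) p * c⁻ π)) ⟩
    ∑ᴸ Bₙ (λ π → (suc n ∸ s) * term p π) + ∑ᴸ Bₙ (λ π → (suc p ∸ s) * (δ (q π) p * c⁻ π))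
      ≡⟨ cong₂ _+_ (∑ᴸ-*ˡ Bₙ (suc n ∸ s) (term p))
                   (trans (∑ᴸ-*ˡ Bₙ (suc p ∸ s) (λ π → δ (q π) p * c⁻ π)) (cong ((suc p ∸ s) *_) (∑-choose⁻ n s p))) ⟩
    (suc n ∸ s) * descentMoment n s p + (suc p ∸ s) * descentMoment⁻ n s p ∎

descentMoment-vanishʳ : ∀ n s {p} → n < p → descentMoment n s p ≡ 0
descentMoment-vanishʳ n s n<p = ∑ᴸ-zero (signedPerms n)
  (λ π → cong (_* posDes π choose s) (δ-≢ (λ q≡p → ℕ.<-irrefl q≡p (ℕ.≤-<-trans (positiveLetters≤n π) n<p))))

descentMoment-vanishˡ : ∀ n {s p} → p < s → descentMoment n s p ≡ 0
descentMoment-vanishˡ n {s} {p} p<s = ∑ᴸ-zero (signedPerms n) vanish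
  where
  vanish : ∀ π → δ (positiveLetters π) p * posDes π choose s ≡ 0
  vanish π with positiveLetters π ℕ.≟ p
  ... | yes q≡p = trans (cong (δ (positiveLetters π) p *_)
                              (choose-vanish (ℕ.≤-<-trans (posDes≤positiveLetters π) (subst (_< s) (sym q≡p) p<s))))
                       (ℕ.*-zeroʳ (δ (positiveLetters π) p))
  ... | no  q≢p  = cong (_* posDes π choose s) (δ-≢ q≢p)

-- The closed form of the moments

falling : ℕ → ℕ → ℕ
falling l p = l ! * (l + p) choose l

falling-suc-zero : ∀ l → falling (suc l) 0 ≡ suc l * falling l 0
falling-suc-zero l = begin
  suc l ! * (suc l + 0) choose suc l  ≡⟨ cong (λ m → suc l ! * m choose suc l) (ℕ.+-identityʳ (suc l)) ⟩
  suc l ! * suc l choose suc l        ≡⟨ cong (suc l ! *_) (choose-diag (suc l)) ⟩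
  suc l ! * 1                         ≡⟨ cong (λ m → suc l ! * m) (trans (sym (choose-diag l)) (cong (_choose l) (sym (ℕ.+-identityʳ l)))) ⟩
  suc l * l ! * (l + 0) choose l      ≡⟨ ℕ.*-assoc (suc l) (l !) _ ⟩
  suc l * falling l 0                 ∎

falling-suc-suc : ∀ l q → falling (suc l) (suc q) ≡ falling (suc l) q + suc l * falling l (suc q)
falling-suc-suc l q = begin
  suc l ! * ((l + suc q) choose l + (l + suc q) choose suc l)
    ≡⟨ cong (λ m → suc l ! * ((l + suc q) choose l + m choose suc l)) (ℕ.+-suc l q) ⟩
  suc l ! * ((l + suc q) choose l + (suc l + q) choose suc l)
    ≡⟨ regroup (suc l) (l !) ((l + suc q) choose l) ((suc l + q) choose suc l) ⟩
  suc l ! * (suc l + q) choose suc l + suc l * (l ! * (l + suc q) choose l) ∎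
  where
  regroup : ∀ k f a b → k * f * (a + b) ≡ k * f * b + k * (f * a)
  regroup = solve-∀

closedForm : ℕ → ℕ → ℕ → ℕ
closedForm l j p = falling l p * (l + j) choose j * surjections p j

-- The terms of descentMoment-rec evaluated at the closed form; they vanish for j, s, resp. l = 0.
closedTerm₁ closedTerm₂ closedTerm₃ : ℕ → ℕ → ℕ → ℕ
closedTerm₁ l zero    s = 0
closedTerm₁ l (suc j) s = (l + suc j) * closedForm l j (s + j)
closedTerm₂ l j zero    = 0
closedTerm₂ l j (suc s) = j * closedForm l j (s + j)
closedTerm₃ zero    j s = 0
closedTerm₃ (suc l) j s = (suc l + j) * closedForm l j (s + j)

private
  closedTerm₂-suc : ∀ l j s → closedTerm₂ l (suc j) s ≡ suc j * (falling l (s + j) * (l + suc j) choose suc j * surjections (s + j) (suc j))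
  closedTerm₂-suc l j zero    = sym (begin
    suc j * (falling l j * B * surjections j (suc j)) ≡⟨ cong (λ x → suc j * (falling l j * B * x)) (surjections-vanish {j} ℕ.≤-refl) ⟩
    suc j * (falling l j * B * 0)                     ≡⟨ cong (suc j *_) (ℕ.*-zeroʳ (falling l j * B)) ⟩
    suc j * 0                                         ≡⟨ ℕ.*-zeroʳ (suc j) ⟩
    0                                                 ∎)
    where B = (l + suc j) choose suc j
  closedTerm₂-suc l j (suc s) = cong (λ p → suc j * (falling l p * (l + suc j) choose suc j * surjections p (suc j))) (ℕ.+-suc s j)

  closedTerm₁+closedTerm₂ : ∀ l j s →
    closedTerm₁ l (suc j) s + closedTerm₂ l (suc j) s ≡ falling l (s + j) * (l + suc j) choose suc j * surjections (suc (s + j)) (suc j)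
  closedTerm₁+closedTerm₂ l j s = begin
    (l + suc j) * (G * B₀ * S₀) + closedTerm₂ l (suc j) s  ≡⟨ cong₂ _+_ (reassoc (l + suc j) G B₀ S₀) (closedTerm₂-suc l j s) ⟩
    G * ((l + suc j) * B₀) * S₀ + suc j * (G * B * S₁) ≡⟨ cong (λ x → G * x * S₀ + suc j * (G * B * S₁)) (choose-absorb-+ʳ l j) ⟩
    G * (suc j * B) * S₀ + suc j * (G * B * S₁)      ≡⟨ collect G (suc j) B S₀ S₁ ⟩
    G * B * (suc j * (S₁ + S₀))                      ∎
    where
    G  = falling l (s + j)
    B  = (l + suc j) choose suc j
    B₀ = (l + j) choose j
    S₀ = surjections (s + j) j
    S₁ = surjections (s + j) (suc j)
    reassoc : ∀ c G B S → c * (G * B * S) ≡ G * (c * B) * S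
    reassoc = solve-∀
    collect : ∀ G J B S₀ S₁ → G * (J * B) * S₀ + J * (G * B * S₁) ≡ G * B * (J * (S₁ + S₀))
    collect = solve-∀

closedForm-rec : ∀ l j s → 1 ≤ l + (s + j) → closedForm l j (s + j) ≡ closedTerm₁ l j s + closedTerm₂ l j s + closedTerm₃ l j s
closedForm-rec zero    zero zero ()
closedForm-rec (suc l) zero zero _ = begin
  falling (suc l) 0 * (suc l + 0) choose 0 * 1      ≡⟨ cong (λ x → x * 1 * 1) (falling-suc-zero l) ⟩
  suc l * falling l 0 * 1 * 1                        ≡⟨ reassoc (suc l) (falling l 0) ⟩
  suc l * (falling l 0 * 1 * 1)                      ≡⟨ cong (_* (falling l 0 * 1 * 1)) (ℕ.+-identityʳ (suc l)) ⟨
  (suc l + 0) * (falling l 0 * (l + 0) choose 0 * 1) ∎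
  where
  reassoc : ∀ a b → a * b * 1 * 1 ≡ a * (b * 1 * 1)
  reassoc = solve-∀
closedForm-rec zero    zero (suc s) _ = ℕ.*-zeroʳ (falling 0 (suc s + 0) * 1)
closedForm-rec (suc l) zero (suc s) _ = begin
  falling (suc l) (suc s + 0) * 1 * 0                ≡⟨ ℕ.*-zeroʳ (falling (suc l) (suc s + 0) * 1) ⟩
  0                                                  ≡⟨ ℕ.*-zeroʳ (suc l + 0) ⟨
  (suc l + 0) * 0                                    ≡⟨ cong ((suc l + 0) *_) (ℕ.*-zeroʳ (falling l (suc s + 0) * 1)) ⟨
  (suc l + 0) * (falling l (suc s + 0) * 1 * 0)      ∎
closedForm-rec zero    (suc j) s _ = begin
  closedForm 0 (suc j) (s + suc j)                                  ≡⟨ cong (closedForm 0 (suc j)) (ℕ.+-suc s j) ⟩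
  falling 0 (s + j) * (0 + suc j) choose suc j * surjections (suc (s + j)) (suc j) ≡⟨ closedTerm₁+closedTerm₂ 0 j s ⟨
  closedTerm₁ 0 (suc j) s + closedTerm₂ 0 (suc j) s                             ≡⟨ ℕ.+-identityʳ _ ⟨
  closedTerm₁ 0 (suc j) s + closedTerm₂ 0 (suc j) s + 0                         ∎
closedForm-rec (suc l) (suc j) s _ = begin
  closedForm (suc l) (suc j) (s + suc j)
    ≡⟨ cong (closedForm (suc l) (suc j)) (ℕ.+-suc s j) ⟩
  falling (suc l) (suc q) * B * S
    ≡⟨ cong (λ x → x * B * S) (falling-suc-suc l q) ⟩
  (falling (suc l) q + suc l * G′) * B * S
    ≡⟨ distribute (falling (suc l) q) (suc l) G′ B S ⟩
  falling (suc l) q * B * S + G′ * (suc l * B) * S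
    ≡⟨ cong₂ (λ x y → x + G′ * y * S) (closedTerm₁+closedTerm₂ (suc l) j s) (choose-absorb-+ˡ l (suc j)) ⟨
  closedTerm₁ (suc l) (suc j) s + closedTerm₂ (suc l) (suc j) s + G′ * ((suc l + suc j) * B′) * S
    ≡⟨ cong (_+_ (closedTerm₁ (suc l) (suc j) s + closedTerm₂ (suc l) (suc j) s)) (reassoc G′ (suc l + suc j) B′ S) ⟩
  closedTerm₁ (suc l) (suc j) s + closedTerm₂ (suc l) (suc j) s + (suc l + suc j) * (G′ * B′ * S)
    ≡⟨ cong (λ p → closedTerm₁ (suc l) (suc j) s + closedTerm₂ (suc l) (suc j) s + (suc l + suc j) * closedForm l (suc j) p) (ℕ.+-suc s j) ⟨
  closedTerm₁ (suc l) (suc j) s + closedTerm₂ (suc l) (suc j) s + closedTerm₃ (suc l) (suc j) s ∎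
  where
  q  = s + j
  G′ = falling l (suc q)
  B  = (suc l + suc j) choose suc j
  B′ = (l + suc j) choose suc j
  S  = surjections (suc q) (suc j)
  distribute : ∀ G k G′ B S → (G + k * G′) * B * S ≡ G * B * S + G′ * (k * B) * S
  distribute = solve-∀
  reassoc : ∀ G′ c B′ S → G′ * (c * B′) * S ≡ c * (G′ * B′ * S)
  reassoc = solve-∀

ClosedFormAt : ℕ → Set
ClosedFormAt n = ∀ l j s → l + (s + j) ≡ n → descentMoment n s (s + j) ≡ closedForm l j (s + j)

private
  ∸-middle : ∀ l s j → l + (s + j) ∸ s ≡ l + j
  ∸-middle l s j = trans (cong (_∸ s) (x∙yz≈y∙xz l s j)) (ℕ.m+n∸m≡n s (l + j))

  momentTerm₁-closed : ∀ {n} l j s → ClosedFormAt n → l + (s + j) ≡ suc n → momentTerm₁ n s (s + j) ≡ closedTerm₁ l j s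
  momentTerm₁-closed     l zero    zero    ih eq = refl
  momentTerm₁-closed {n} l zero    (suc s) ih eq =
    trans (cong ((n ∸ s) *_) (descentMoment-vanishˡ n (s≤s (ℕ.≤-reflexive (ℕ.+-identityʳ s))))) (ℕ.*-zeroʳ (n ∸ s))
  momentTerm₁-closed {n} l (suc j) s ih eq = begin
    momentTerm₁ n s (s + suc j)              ≡⟨ cong (momentTerm₁ n s) (ℕ.+-suc s j) ⟩
    (suc n ∸ s) * descentMoment n s (s + j)  ≡⟨ cong₂ _*_ coefficient (ih l j s eq′) ⟩
    (l + suc j) * closedForm l j (s + j)     ∎
    where
    eq′ : l + (s + j) ≡ n
    eq′ = ℕ.suc-injective (trans (sym (trans (cong (_+_ l) (ℕ.+-suc s j)) (ℕ.+-suc l (s + j)))) eq)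
    coefficient : suc n ∸ s ≡ l + suc j
    coefficient = trans (cong (_∸ s) (sym eq)) (∸-middle l s (suc j))

  momentTerm₂-closed : ∀ {n} l j s → ClosedFormAt n → l + (s + j) ≡ suc n → momentTerm₂ n s (s + j) ≡ closedTerm₂ l j s
  momentTerm₂-closed     l zero    zero    ih eq = refl
  momentTerm₂-closed     l (suc j) zero    ih eq = ℕ.*-zeroʳ (suc j)
  momentTerm₂-closed {n} l j       (suc s) ih eq =
    cong₂ _*_ (ℕ.m+n∸m≡n s j) (ih l j s (ℕ.suc-injective (trans (sym (ℕ.+-suc l (s + j))) eq)))

  momentTerm₃-closed : ∀ {n} l j s → ClosedFormAt n → l + (s + j) ≡ suc n → (suc n ∸ s) * descentMoment n s (s + j) ≡ closedTerm₃ l j s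
  momentTerm₃-closed {n} zero    j s ih eq =
    trans (cong ((suc n ∸ s) *_) (descentMoment-vanishʳ n s (ℕ.≤-reflexive (sym eq)))) (ℕ.*-zeroʳ (suc n ∸ s))
  momentTerm₃-closed {n} (suc l) j s ih eq =
    cong₂ _*_ (trans (cong (_∸ s) (sym eq)) (∸-middle (suc l) s j)) (ih l j s (ℕ.suc-injective eq))

descentMoment-closedForm : ∀ n → ClosedFormAt n
descentMoment-closedForm zero    zero j s eq with s | j | eq
... | zero | zero | refl = refl
descentMoment-closedForm (suc n) l    j s eq = begin
  descentMoment (suc n) s (s + j)
    ≡⟨ descentMoment-rec n s (s + j) ⟩
  momentTerm₁ n s (s + j) + momentTerm₂ n s (s + j) + (suc n ∸ s) * descentMoment n s (s + j)
    ≡⟨ cong₂ _+_ (cong₂ _+_ (momentTerm₁-closed l j s ih eq) (momentTerm₂-closed l j s ih eq)) (momentTerm₃-closed l j s ih eq) ⟩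
  closedTerm₁ l j s + closedTerm₂ l j s + closedTerm₃ l j s
    ≡⟨ closedForm-rec l j s (subst (1 ≤_) (sym eq) (s≤s z≤n)) ⟨
  closedForm l j (s + j) ∎
  where
  ih = descentMoment-closedForm n

sumTo≡∑ : ∀ N (f : ℕ → ℤ) → sumTo N f ≡ ℤ∑.∑ (suc N) f
sumTo≡∑ N f = go id (suc N)
  where
  go : ∀ g n → foldr (λ x acc → f x +ℤ acc) (+ 0) (applyUpTo g n) ≡ ℤ∑.∑ n (f ∘ g)
  go g zero    = refl
  go g (suc n) = cong (f (g 0) +ℤ_) (go (g ∘ suc) n)

binomialMoment : ℕ → ℕ → ℕ
binomialMoment n s = ∑ᴸ (signedPerms n) (λ π → posDes π choose s)

binomialMoment-∑ : ∀ n s → binomialMoment n s ≡ ∑ (suc n) (descentMoment n s)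
binomialMoment-∑ n s = begin
  ∑ᴸ (signedPerms n) (λ π → posDes π choose s)
    ≡⟨ ∑ᴸ-cong (signedPerms n) (λ π → ∑-δ (suc n) (positiveLetters π) (posDes π choose s) (s≤s (positiveLetters≤n π))) ⟨
  ∑ᴸ (signedPerms n) (λ π → ∑ (suc n) (λ p → δ (positiveLetters π) p * posDes π choose s))
    ≡⟨ ∑ᴸ-∑-comm (signedPerms n) (suc n) (λ π p → δ (positiveLetters π) p * posDes π choose s) ⟩
  ∑ (suc n) (descentMoment n s) ∎

formulaCoefficient formulaInner : ℕ → ℕ → ℕ → ℕ
formulaCoefficient n i j = (i ∸ j) ! * n choose (i ∸ j) * i choose j
formulaInner n i j = formulaCoefficient n i j * surjections (n + j ∸ i) j

binomialMoment-closed : ∀ {n s} → s ≤ n → binomialMoment n s ≡ ∑ (suc (n ∸ s)) (formulaInner n (n ∸ s))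
binomialMoment-closed {n} {s} s≤n = begin
  binomialMoment n s
    ≡⟨ binomialMoment-∑ n s ⟩
  ∑ (suc n) (descentMoment n s)
    ≡⟨ cong (λ k → ∑ k (descentMoment n s)) (trans (ℕ.+-suc s i) (cong suc (ℕ.m+[n∸m]≡n s≤n))) ⟨
  ∑ (s + suc i) (descentMoment n s)
    ≡⟨ ∑-shift s (suc i) (descentMoment n s) (λ p p<s → descentMoment-vanishˡ n p<s) ⟩
  ∑ (suc i) (λ j → descentMoment n s (s + j))
    ≡⟨ ∑-cong (suc i) (λ j j≤i → trans (descentMoment-closedForm n (i ∸ j) j s (size j≤i)) (closed j≤i)) ⟩
  ∑ (suc i) (formulaInner n i) ∎
  where
  i = n ∸ s
  size : ∀ {j} → j < suc i → i ∸ j + (s + j) ≡ n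
  size {j} (s≤s j≤i) = trans (x∙yz≈y∙xz (i ∸ j) s j) (trans (cong (_+_ s) (ℕ.m∸n+n≡m j≤i)) (ℕ.m+[n∸m]≡n s≤n))
  closed : ∀ {j} → j < suc i → closedForm (i ∸ j) j (s + j) ≡ formulaInner n i j
  closed {j} j<1+i@(s≤s j≤i) = cong₃ (λ a b c → (i ∸ j) ! * a choose (i ∸ j) * b choose j * surjections c j)
    (size j<1+i) (ℕ.m∸n+n≡m j≤i) exponent
    where
    exponent : s + j ≡ n + j ∸ i
    exponent = sym (trans (cong (λ k → k + j ∸ i) (sym (ℕ.m+[n∸m]≡n s≤n)))
                          (trans (cong (_∸ i) (xy∙z≈xz∙y s i j)) (ℕ.m+n∸n≡m (s + j) i)))
    cong₃ : ∀ (f : ℕ → ℕ → ℕ → ℕ) {a a′ b b′ c c′} → a ≡ a′ → b ≡ b′ → c ≡ c′ → f a b c ≡ f a′ b′ c′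
    cong₃ f refl refl refl = refl

count-by-inversion : ∀ n m → + ∑ᴸ (signedPerms n) (λ π → δ (posDes π) m)
                            ≡ ℤ∑.∑ (suc n) (λ s → sgn (s + m) *ℤ + (s choose m * binomialMoment n s))
count-by-inversion n m = begin
  + ∑ᴸ (signedPerms n) (λ π → δ (posDes π) m)
    ≡⟨ +-∑ᴸ (signedPerms n) (λ π → δ (posDes π) m) ⟩
  ℤ∑.∑ᴸ (signedPerms n) (λ π → + δ (posDes π) m)
    ≡⟨ ℤ∑.∑ᴸ-cong (signedPerms n) (λ π → binomial-inversion m (s≤s (posDes≤n π))) ⟨
  ℤ∑.∑ᴸ (signedPerms n) (λ π → ℤ∑.∑ (suc n) (inversionTerm (posDes π) m))
    ≡⟨ ℤ∑.∑ᴸ-∑-comm (signedPerms n) (suc n) (λ π → inversionTerm (posDes π) m) ⟩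
  ℤ∑.∑ (suc n) (λ s → ℤ∑.∑ᴸ (signedPerms n) (λ π → inversionTerm (posDes π) m s))
    ≡⟨ ℤ∑.∑-cong (suc n) (λ s _ → factor s) ⟩
  ℤ∑.∑ (suc n) (λ s → sgn (s + m) *ℤ + (s choose m * binomialMoment n s)) ∎
  where
  factor : ∀ s → ℤ∑.∑ᴸ (signedPerms n) (λ π → inversionTerm (posDes π) m s) ≡ sgn (s + m) *ℤ + (s choose m * binomialMoment n s)
  factor s = begin
    ℤ∑.∑ᴸ (signedPerms n) (λ π → sgn (s + m) *ℤ + (s choose m * posDes π choose s))
      ≡⟨ ℤ∑.∑ᴸ-*ˡ (signedPerms n) (sgn (s + m)) (λ π → + (s choose m * posDes π choose s)) ⟩
    sgn (s + m) *ℤ ℤ∑.∑ᴸ (signedPerms n) (λ π → + (s choose m * posDes π choose s))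
      ≡⟨ cong (sgn (s + m) *ℤ_) (+-∑ᴸ (signedPerms n) (λ π → s choose m * posDes π choose s)) ⟨
    sgn (s + m) *ℤ + ∑ᴸ (signedPerms n) (λ π → s choose m * posDes π choose s)
      ≡⟨ cong (λ x → sgn (s + m) *ℤ + x) (∑ᴸ-*ˡ (signedPerms n) (s choose m) (λ π → posDes π choose s)) ⟩
    sgn (s + m) *ℤ + (s choose m * binomialMoment n s) ∎

private
  formulaTerm-split : ∀ n m i j k →
    sgn (i + j + k + n + m) *ℤ + ((k ^ (n + j ∸ i)) * ((i ∸ j) !) * (n C (i ∸ j)) * (i C j) * (j C k) * ((n ∸ i) C m))
      ≡ (sgn (i + n + m) *ℤ + ((n ∸ i) choose m * formulaCoefficient n i j)) *ℤ surjectionTerm (n + j ∸ i) j k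
  formulaTerm-split n m i j k = begin
    sgn (i + j + k + n + m) *ℤ + (K * a * (n C (i ∸ j)) * (i C j) * (j C k) * ((n ∸ i) C m))
      ≡⟨ cong₂ (λ σ x → σ *ℤ + x) (trans (cong sgn (parity i j k n m)) (sgn-+ (i + n + m) (j + k)))
               (sym (cong₄ (λ b c d f → K * a * b * c * d * f) (choose≡C n (i ∸ j)) (choose≡C i j) (choose≡C j k) (choose≡C (n ∸ i) m))) ⟩
    σ *ℤ τ *ℤ + (K * a * n choose (i ∸ j) * i choose j * j choose k * (n ∸ i) choose m)
      ≡⟨ cong (λ x → σ *ℤ τ *ℤ + x) (regroup K a (n choose (i ∸ j)) (i choose j) (j choose k) ((n ∸ i) choose m)) ⟩
    σ *ℤ τ *ℤ + ((n ∸ i) choose m * formulaCoefficient n i j * (K * j choose k))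
      ≡⟨ cong (σ *ℤ τ *ℤ_) (ℤ.pos-* ((n ∸ i) choose m * formulaCoefficient n i j) (K * j choose k)) ⟩
    σ *ℤ τ *ℤ (+ ((n ∸ i) choose m * formulaCoefficient n i j) *ℤ + (K * j choose k))
      ≡⟨ swap-middle σ τ _ _ ⟩
    σ *ℤ + ((n ∸ i) choose m * formulaCoefficient n i j) *ℤ (τ *ℤ + (K * j choose k)) ∎
    where
    σ = sgn (i + n + m)
    τ = sgn (j + k)
    K = k ^ (n + j ∸ i)
    a = (i ∸ j) !
    parity : ∀ i j k n m → i + j + k + n + m ≡ i + n + m + (j + k)
    parity = solve-∀
    regroup : ∀ K a b c d f → K * a * b * c * d * f ≡ f * (a * b * c) * (K * d)
    regroup = solve-∀
    swap-middle : ∀ σ τ y z → σ *ℤ τ *ℤ (y *ℤ z) ≡ σ *ℤ y *ℤ (τ *ℤ z)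
    swap-middle = ℤ-Ring.solve-∀
    cong₄ : ∀ (f : ℕ → ℕ → ℕ → ℕ → ℕ) {a a′ b b′ c c′ d d′} → a ≡ a′ → b ≡ b′ → c ≡ c′ → d ≡ d′ → f a b c d ≡ f a′ b′ c′ d′
    cong₄ f refl refl refl refl = refl

formula-k-sum : ∀ n m i j →
  sumTo j (λ k → sgn (i + j + k + n + m) *ℤ + ((k ^ (n + j ∸ i)) * ((i ∸ j) !) * (n C (i ∸ j)) * (i C j) * (j C k) * ((n ∸ i) C m)))
    ≡ sgn (i + n + m) *ℤ + ((n ∸ i) choose m * formulaInner n i j)
formula-k-sum n m i j = begin
  sumTo j (λ k → formulaTerm k)
    ≡⟨ sumTo≡∑ j formulaTerm ⟩
  ℤ∑.∑ (suc j) formulaTerm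
    ≡⟨ ℤ∑.∑-cong (suc j) (λ k _ → formulaTerm-split n m i j k) ⟩
  ℤ∑.∑ (suc j) (λ k → σ *ℤ + c *ℤ surjectionTerm e j k)
    ≡⟨ ℤ∑.∑-*ˡ (suc j) (σ *ℤ + c) (surjectionTerm e j) ⟩
  σ *ℤ + c *ℤ ℤ∑.∑ (suc j) (surjectionTerm e j)
    ≡⟨ cong (σ *ℤ + c *ℤ_) (∑-surjectionTerm e j) ⟩
  σ *ℤ + c *ℤ + surjections e j
    ≡⟨ ℤ.*-assoc σ (+ c) (+ surjections e j) ⟩
  σ *ℤ (+ c *ℤ + surjections e j)
    ≡⟨ cong (σ *ℤ_) (trans (sym (ℤ.pos-* c (surjections e j))) (cong +_ (ℕ.*-assoc ((n ∸ i) choose m) _ (surjections e j)))) ⟩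
  σ *ℤ + ((n ∸ i) choose m * formulaInner n i j) ∎
  where
  e = n + j ∸ i
  σ = sgn (i + n + m)
  c = (n ∸ i) choose m * formulaCoefficient n i j
  formulaTerm = λ k → sgn (i + j + k + n + m) *ℤ + ((k ^ e) * ((i ∸ j) !) * (n C (i ∸ j)) * (i C j) * (j C k) * ((n ∸ i) C m))

formula-∑ : ∀ n m → formula n m ≡ ℤ∑.∑ (suc n) (λ i → sgn (i + n + m) *ℤ + ((n ∸ i) choose m * ∑ (suc i) (formulaInner n i)))
formula-∑ n m = trans (sumTo≡∑ n (λ i → sumTo i (jTerm i))) (ℤ∑.∑-cong (suc n) (λ i _ → j-sum i))
  where
  jTerm : ℕ → ℕ → ℤ
  jTerm i j = sumTo j (λ k → sgn (i + j + k + n + m) *ℤ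
                + ((k ^ ((n + j) ∸ i)) * ((i ∸ j) !) * (n C (i ∸ j)) * (i C j) * (j C k) * ((n ∸ i) C m)))
  j-sum : ∀ i → sumTo i (jTerm i) ≡ sgn (i + n + m) *ℤ + ((n ∸ i) choose m * ∑ (suc i) (formulaInner n i))
  j-sum i = begin
    sumTo i (jTerm i)
      ≡⟨ sumTo≡∑ i (jTerm i) ⟩
    ℤ∑.∑ (suc i) (jTerm i)
      ≡⟨ ℤ∑.∑-cong (suc i) (λ j _ → formula-k-sum n m i j) ⟩
    ℤ∑.∑ (suc i) (λ j → sgn (i + n + m) *ℤ + ((n ∸ i) choose m * formulaInner n i j))
      ≡⟨ ℤ∑.∑-*ˡ (suc i) (sgn (i + n + m)) (λ j → + ((n ∸ i) choose m * formulaInner n i j)) ⟩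
    sgn (i + n + m) *ℤ ℤ∑.∑ (suc i) (λ j → + ((n ∸ i) choose m * formulaInner n i j))
      ≡⟨ cong (sgn (i + n + m) *ℤ_) (+-∑ (suc i) (λ j → (n ∸ i) choose m * formulaInner n i j)) ⟨
    sgn (i + n + m) *ℤ + ∑ (suc i) (λ j → (n ∸ i) choose m * formulaInner n i j)
      ≡⟨ cong (λ x → sgn (i + n + m) *ℤ + x) (∑-*ˡ (suc i) ((n ∸ i) choose m) (formulaInner n i)) ⟩
    sgn (i + n + m) *ℤ + ((n ∸ i) choose m * ∑ (suc i) (formulaInner n i)) ∎

formula≡count : ∀ n m → formula n m ≡ + ∑ᴸ (signedPerms n) (λ π → δ (posDes π) m)
formula≡count n m = begin
  formula n m
    ≡⟨ formula-∑ n m ⟩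
  ℤ∑.∑ (suc n) f
    ≡⟨ ℤ∑.∑-reverse (suc n) f ⟩
  ℤ∑.∑ (suc n) (λ s → f (n ∸ s))
    ≡⟨ ℤ∑.∑-cong (suc n) (λ s s<1+n → reindex (s≤s⁻¹ s<1+n)) ⟩
  ℤ∑.∑ (suc n) (λ s → sgn (s + m) *ℤ + (s choose m * binomialMoment n s))
    ≡⟨ count-by-inversion n m ⟨
  + ∑ᴸ (signedPerms n) (λ π → δ (posDes π) m) ∎
  where
  f : ℕ → ℤ
  f i = sgn (i + n + m) *ℤ + ((n ∸ i) choose m * ∑ (suc i) (formulaInner n i))
  reindex : ∀ {s} → s ≤ n → f (n ∸ s) ≡ sgn (s + m) *ℤ + (s choose m * binomialMoment n s)
  reindex {s} s≤n = cong₂ (λ σ x → σ *ℤ + x) sign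
    (cong₂ _*_ (cong (_choose m) (ℕ.m∸[m∸n]≡n s≤n)) (sym (binomialMoment-closed s≤n)))
    where
    sign : sgn (n ∸ s + n + m) ≡ sgn (s + m)
    sign = begin
      sgn (n ∸ s + n + m)              ≡⟨ cong (λ k → sgn (n ∸ s + k + m)) (ℕ.m∸n+n≡m s≤n) ⟨
      sgn (n ∸ s + (n ∸ s + s) + m)    ≡⟨ cong sgn (regroup (n ∸ s) s m) ⟩
      sgn (n ∸ s + (n ∸ s) + (s + m))  ≡⟨ sgn-+ (n ∸ s + (n ∸ s)) (s + m) ⟩
      sgn (n ∸ s + (n ∸ s)) *ℤ sgn (s + m) ≡⟨ cong (_*ℤ sgn (s + m)) (sgn-double (n ∸ s)) ⟩
      + 1 *ℤ sgn (s + m)               ≡⟨ ℤ.*-identityˡ (sgn (s + m)) ⟩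
      sgn (s + m)                      ∎
      where
      regroup : ∀ a s m → a + (a + s) + m ≡ a + a + (s + m)
      regroup = solve-∀

proposition2 : (n m : ℕ) → Σ ℕ λ N →
    (formula n m ≡ + N) × (WithPosDes n m ↔ Fin N) × (WithNegDes n m ↔ Fin N)
proposition2 n m = N , formula≡N , WithPosDes↔Fin , ↔-trans (WithNegDes↔WithPosDes n m) WithPosDes↔Fin
  where
  posDes≟m : Decidable (λ (π : SignedPerm n) → posDes π ≡ m)
  posDes≟m π = posDes π ℕ.≟ m
  N = length (filter posDes≟m (signedPerms n))
  formula≡N : formula n m ≡ + N
  formula≡N = trans (formula≡count n m) (cong +_ (sym (length-filter-≟ posDes m (signedPerms n))))
  WithPosDes↔Fin : WithPosDes n m ↔ Fin N
  WithPosDes↔Fin = Σ↔Fin-length-filter posDes≟m ℕ.≡-irrelevant ∈-signedPerms (signedPerms-unique n)
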